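{- Let $E$ be a set of designs based on $\beta$ and let $\mathfrak R\in|E^\perp|$. Then there exists $C\subseteq V_E$ such that for every design $\mathfrak D\in E$, $C\cap\mathcal P(\mathfrak D)\ne\emptyset$, $\widetilde C=\{\widetilde p:p\in C\}$ is a clique of $\widetilde{V_E}$, and $\ulcorner\widetilde C^*\urcorner=\mathfrak R$, where $\ulcorner\widetilde C^*\urcorner$ is the set of views of non-empty prefixes of elements of $\widetilde C$.
   Context: Ludics (Girard). Actions: proper $(\epsilon,\xi,I)$ (polarity $\epsilon\in\{+,-\}$, focus a locus $\xi$ = finite sequence of naturals, finite ramification $I$) or the positive daimon $\maltese$; $(\epsilon,\xi.i,J)$ is justified by $(\bar\epsilon,\xi,I)$ if $i\in I$; $\overline{(\pm,\xi,I)}=(\mp,\xi,I)$ letterwise. Designs on a base $\Gamma\vdash\Delta$ are prefix-closed, pairwise coherent, positive-ended, total sets of chronicles (alternating, justified, linear sequences) as in Ludics; nets are finite sets of designs on disjoint bases. Views: $\ulcorner w\kappa^+\urcorner=\ulcorner w\urcorner\kappa^+$, $\ulcorner w\kappa^-\urcorner=\ulcorner w_0\urcorner\kappa^-$, $w_0$ empty if $\kappa^-$ is initial, else the prefix of $w$ ending with the justifier of $\kappa^-$. Paths on a base of net (finite set of sequents $\Gamma_i\vdash\Delta_i$ of disjoint loci, each $\Gamma_i$ a singleton except at most one empty): finite alternating sequences of actions hereditarily justified from the base, proper actions justified by earlier ones or initial, distinct focuses, daimon only last, every positive proper action justified by a negative $\kappa'$ having $\kappa'$ in the view of the preceding prefix,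 initial positive actions on $\Delta_i$ first (with $\Gamma_i=\emptyset$) or immediately preceded by a negative action hereditarily justified from $\Gamma_i\cup\Delta_i$, non-empty and starting with $\maltese$ or a positive action on $\Delta_i$ when some $\Gamma_i=\emptyset$. Two paths $p_1,p_2$ on the same base are coherent when: their first actions have same polarity and are equal if positive; prefixes $w_1\kappa_1^+,w_2\kappa_2^+$ with $\ulcorner w_1\urcorner=\ulcorner w_2\urcorner$ have $\kappa_1^+=\kappa_2^+$; and for prefixes $w_1\kappa_1^-,w_2\kappa_2^-$ whose justifier-prefixes $w_j^0$ (empty if initial) satisfy $\ulcorner w_1^0\urcorner=\ulcorner w_2^0\urcorner$ and with $\kappa_1^-,\kappa_2^-$ of distinct focuses, all later actions $\sigma_j$ of $p_j$ with $\kappa_j^-$ in the view of the prefix ending at $\sigma_j$ have distinct focuses. A clique: pairwise coherent. $\mathcal P(\mathfrak D)$: paths all of whose non-empty prefix-views are chronicles of $\mathfrak D$. For $\beta=\xi\vdash\sigma_1,\dots,\sigma_n$ (resp. $\vdash\sigma_1,\dots,\sigma_n$), $\beta^\perp$ is $\vdash\xi,\sigma_1\vdash,\dots$ (resp. $\sigma_1\vdash,\dots$). A net $\mathfrak R$ on $\beta^\perp$ is orthogonal to $\mathfrak D$ on $\beta$ if normalization of $(\mathfrak D,\mathfrak R)$ converges (at each step the first action $(+,\sigma,I)$ of the unique positive-base design must be matched by a chronicle starting with $(-,\sigma,I)$ in the design with left locus $\sigma$, both then being replaced by the following subdesigns, until a daimon is reached); $E^\perp$ is the set of nets orthogonal to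 all of $E$. $\langle\mathfrak D\leftarrow\mathfrak R\rangle$ ($\langle\mathfrak R\leftarrow\mathfrak D\rangle$) is the sequence of actions of $\mathfrak D$ (of $\mathfrak R$) visited during normalization. $V_E$ = set of $\langle\mathfrak D\leftarrow\mathfrak R\rangle$, $\mathfrak D\in E$, $\mathfrak R\in E^\perp$; $\widetilde{V_E}=\{\widetilde p:p\in V_E\}$. Dual: $\widetilde p=\overline w$ if $p=w\maltese$, else $\overline p\maltese$. For $\mathfrak R\in E^\perp$, $|\mathfrak R|_{E^\perp}$ is the net whose component on each sequent of $\beta^\perp$ is the union over $\mathfrak D\in E$ of the chronicles on that sequent of views of prefixes of $\langle\mathfrak R\leftarrow\mathfrak D\rangle$; $|E^\perp|=\{|\mathfrak R|_{E^\perp}:\mathfrak R\in E^\perp\}$. -}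

module Defs where

open import Data.Nat using (ℕ; zero; suc; _+_; _≡ᵇ_)
open import Data.Bool using (Bool; true; false; _∧_; _∨_; if_then_else_; T)
open import Data.List using (List; []; _∷_; _++_; [_]; length; map; reverse; lookup)
open import Data.List.Membership.Propositional using (_∈_; _∉_)
open import Data.List.Relation.Unary.Any using (Any)
open import Data.Maybe using (Maybe; just; nothing)
open import Data.Product using (Σ; ∃; ∃₂; _×_; _,_)
open import Data.Sum using (_⊎_)
open import Data.Empty using (⊥)
open import Data.Fin using (Fin)
open import Relation.Binary.PropositionalEquality using (_≡_; _≢_)
open import Relation.Nullary using (¬_)

-- A locus is a finite sequence of naturals; ξ.i is  ξ ++ [ i ].
Locus : Set
Locus = List ℕ

-- A ramification is a finite subset of ℕ.  Canonical (bijective) encoding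
-- by gaps: [] is ∅, and (d ∷ ds) read from offset o contains o + d and then
-- the set encoded by ds read from offset (o + d + 1).  Every finite subset of
-- ℕ has exactly one code, so propositional equality of codes is equality of sets.
Ram : Set
Ram = List ℕ

memB : ℕ → ℕ → Ram → Bool
memB o i []       = false
memB o i (d ∷ ds) = (i ≡ᵇ (o + d)) ∨ memB (suc (o + d)) i ds

_∈R_ : ℕ → Ram → Set
i ∈R I = T (memB 0 i I)

data Pol : Set where
  pos neg : Pol

opp : Pol → Pol
opp pos = neg
opp neg = pos

data Action : Set where
  daimon : Action
  act    : Pol → Locus → Ram → Action

pol : Action → Pol
pol daimon        = pos
pol (act e _ _)   = e

focus : Action → Maybe Locus
focus daimon       = nothing
focus (act _ ξ _)  = just ξ

DistinctFocus : Action → Action → Set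
DistinctFocus a b = ∀ ξ → focus a ≡ just ξ → focus b ≡ just ξ → ⊥

data IsProper : Action → Set where
  proper : ∀ e ξ I → IsProper (act e ξ I)

data IsProperPos : Action → Set where
  properPos : ∀ ξ I → IsProperPos (act pos ξ I)

dualA : Action → Action
dualA daimon      = daimon
dualA (act e ξ I) = act (opp e) ξ I

dualSeq : List Action → List Action
dualSeq = map dualA

-- dual of a path:  p~ = dual w  if p = w ✠,  and  dual p ✠  otherwise
tilde : List Action → List Action
tilde []              = daimon ∷ []
tilde (daimon ∷ [])   = []
tilde (a ∷ r)         = dualA a ∷ tilde r

-- Justification:  (ε, ξ.i, J) is justified by (ε̄, ξ, I) when i ∈ I.

oppB : Pol → Pol → Bool
oppB pos neg = true
oppB neg pos = true
oppB _   _   = false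

childIdx : Locus → Locus → Maybe ℕ
childIdx []      (i ∷ [])  = just i
childIdx (x ∷ ξ) (y ∷ ζ)   = if x ≡ᵇ y then childIdx ξ ζ else nothing
childIdx _       _         = nothing

justIdx : Pol → Pol → Ram → Maybe ℕ → Bool
justIdx e₁ e₂ I (just i) = oppB e₁ e₂ ∧ memB 0 i I
justIdx e₁ e₂ I nothing  = false

-- justB b a : the action b justifies the action a
justB : Action → Action → Bool
justB (act e₂ ξ I) (act e₁ ζ J) = justIdx e₁ e₂ I (childIdx ξ ζ)
justB _ _ = false

JustBy : Action → Action → Set
JustBy a b = T (justB b a)

-- Views.  Computed on the reversed sequence (most recent action first).

mutual
  viewR : List Action → List Action
  viewR []       = []
  viewR (κ ∷ rw) = viewStep (pol κ) κ rw

  viewStep : Pol → Action → List Action → List Action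
  viewStep pos κ rw = κ ∷ viewR rw
  viewStep neg κ rw = κ ∷ seekR κ rw

  -- drop actions until the justifier of κ; continue with the view from there
  -- (nothing left if κ is initial)
  seekR : Action → List Action → List Action
  seekR κ []       = []
  seekR κ (b ∷ rw) = seekStep (justB b κ) κ (b ∷ rw)

  seekStep : Bool → Action → List Action → List Action
  seekStep true  κ l        = viewR l
  seekStep false κ []       = []
  seekStep false κ (_ ∷ rw) = seekR κ rw

-- ⌜ w κ⁺ ⌝ = ⌜ w ⌝ κ⁺ ;  ⌜ w κ⁻ ⌝ = ⌜ w₀ ⌝ κ⁻
view : List Action → List Action
view w = reverse (viewR (reverse w))

seekJ : Action → List Action → List Action
seekJ κ []       = []
seekJ κ (b ∷ rw) = if justB b κ then b ∷ rw else seekJ κ rw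

justPrefix : List Action → Action → List Action
justPrefix w κ = reverse (seekJ κ (reverse w))

record Seq : Set where
  constructor _⊢_
  field
    left  : Maybe Locus
    right : List Locus
open Seq public

maybeList : Maybe Locus → List Locus
maybeList nothing  = []
maybeList (just ξ) = ξ ∷ []

lociOf : Seq → List Locus
lociOf S = maybeList (left S) ++ right S

DisjointLoci : Locus → Locus → Set
DisjointLoci ξ ζ = ¬ (∃ λ u → ζ ≡ ξ ++ u) × ¬ (∃ λ u → ξ ≡ ζ ++ u)

WFBase : Seq → Set
WFBase S = ∀ w ξ u ζ r → lociOf S ≡ w ++ ξ ∷ u ++ ζ ∷ r → DisjointLoci ξ ζ

InitialIn : Seq → Action → Set
InitialIn S daimon        = ⊥
InitialIn S (act pos ξ I) = ξ ∈ right S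
InitialIn S (act neg ξ I) = left S ≡ just ξ

InitialNet : List Seq → Action → Set
InitialNet NB a = Any (λ S → InitialIn S a) NB

Alternating : List Action → Set
Alternating s = ∀ u κ κ' r → s ≡ u ++ κ ∷ κ' ∷ r → pol κ' ≡ opp (pol κ)

DaimonLast : List Action → Set
DaimonLast s = ∀ u r → s ≡ u ++ daimon ∷ r → r ≡ []

Linear : List Action → Set
Linear s = ∀ u κ v κ' r → s ≡ u ++ κ ∷ v ++ κ' ∷ r → DistinctFocus κ κ'

LastPos : List Action → Set
LastPos c = ∃₂ λ u κ → c ≡ u ++ κ ∷ [] × pol κ ≡ pos

record Chronicle (S : Seq) (c : List Action) : Set where
  field
    nonEmpty : c ≢ []
    alt      : Alternating c
    dai      : DaimonLast c
    lin      : Linear c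
    negJ     : ∀ u κ r → c ≡ u ++ κ ∷ r → pol κ ≡ neg →
               (u ≡ [] × InitialIn S κ) ⊎ (∃₂ λ u' b → u ≡ u' ++ b ∷ [] × JustBy κ b)
    posJ     : ∀ u κ r → c ≡ u ++ κ ∷ r → IsProperPos κ →
               InitialIn S κ ⊎ (∃ λ b → b ∈ u × JustBy κ b)
    negBase  : ∀ ξ → left S ≡ just ξ → ∀ κ r → c ≡ κ ∷ r → pol κ ≡ neg

Comparable : List Action → List Action → Set
Comparable c₁ c₂ = (∃ λ u → c₂ ≡ c₁ ++ u) ⊎ (∃ λ u → c₁ ≡ c₂ ++ u)

record CohChron (c₁ c₂ : List Action) : Set where
  field
    diverge : Comparable c₁ c₂ ⊎
              (Σ (List Action) λ w → Σ Action λ κ₁ → Σ (List Action) λ r₁ →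
               Σ Action λ κ₂ → Σ (List Action) λ r₂ →
               c₁ ≡ w ++ κ₁ ∷ r₁ × c₂ ≡ w ++ κ₂ ∷ r₂ × κ₁ ≢ κ₂ ×
               pol κ₁ ≡ neg × pol κ₂ ≡ neg)
    propag  : ∀ w κ₁ r₁ κ₂ r₂ → c₁ ≡ w ++ κ₁ ∷ r₁ → c₂ ≡ w ++ κ₂ ∷ r₂ →
              DistinctFocus κ₁ κ₂ →
              ∀ a b → a ∈ κ₁ ∷ r₁ → b ∈ κ₂ ∷ r₂ → DistinctFocus a b

record Design (B : Seq) : Set₁ where
  field
    chr      : List Action → Set
    isChron  : ∀ c → chr c → Chronicle B c
    prefixCl : ∀ u v → chr (u ++ v) → u ≢ [] → chr u
    coherent : ∀ c₁ c₂ → chr c₁ → chr c₂ → CohChron c₁ c₂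
    posEnded : ∀ c → chr c → (∃ λ κ → chr (c ++ κ ∷ [])) ⊎ LastPos c
    total    : left B ≡ nothing → ∃ λ c → chr c
open Design public

perp : Seq → List Seq
perp β = posPart (left β) ++ map (λ σ → just σ ⊢ []) (right β)
  where
  posPart : Maybe Locus → List Seq
  posPart nothing  = []
  posPart (just ξ) = (nothing ⊢ (ξ ∷ [])) ∷ []

Net : List Seq → Set₁
Net NB = (i : Fin (length NB)) → Design (lookup NB i)

RMem : ∀ NB → Net NB → List Action → Set
RMem NB R c = ∃ λ i → chr (R i) c

-- Normalization of (D, R), D on β, R on β^⊥.
-- w is the sequence ⟨D ← R⟩ of actions of D visited; R's actions are their
-- duals.  Each positive action of D is read in D at the current view of the
-- interaction, each positive action of R in R at the view of R's sequence;
-- normalization converges when a daimon is reached (by D, or by R).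

record Normalizes {β : Seq} (D : Design β) (R : Net (perp β)) (w : List Action) : Set where
  field
    alt    : Alternating w
    dai    : DaimonLast w
    dMoves : ∀ u κ r → w ≡ u ++ κ ∷ r → pol κ ≡ pos → chr D (view (u ++ κ ∷ []))
    rMoves : ∀ u κ r → w ≡ u ++ κ ∷ r → pol κ ≡ neg → RMem (perp β) R (view (dualSeq (u ++ κ ∷ [])))
    ends   : (∃ λ u → w ≡ u ++ daimon ∷ []) ⊎
             (daimon ∉ w × RMem (perp β) R (view (dualSeq w ++ daimon ∷ [])))

-- ⟨R ← D⟩ = tilde ⟨D ← R⟩ (dual actions, daimon moved to the other side)

Orth : ∀ {β} → Design β → Net (perp β) → Set
Orth D R = ∃ λ w → Normalizes D R w

InPerp : ∀ {β} → (Design β → Set) → Net (perp β) → Set₁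
InPerp {β} E R = ∀ (D : Design β) → E D → Orth D R

V : ∀ {β} → (Design β → Set) → List Action → Set₁
V {β} E p = Σ (Design β) λ D → E D × Σ (Net (perp β)) λ R → InPerp E R × Normalizes D R p

Vtilde : ∀ {β} → (Design β → Set) → List Action → Set₁
Vtilde E q = ∃ λ p → V E p × q ≡ tilde p

ViewOfPrefix : List Action → List Action → Set
ViewOfPrefix q c = ∃₂ λ u v → q ≡ u ++ v × u ≢ [] × view u ≡ c

AbsComp : ∀ {β} → (Design β → Set) → Net (perp β) → Fin (length (perp β)) → List Action → Set₁
AbsComp {β} E R i c =
  Chronicle (lookup (perp β) i) c ×
  Σ (Design β) λ D → E D × ∃ λ w → Normalizes D R w × ViewOfPrefix (tilde w) c

-- R ∈ |E^⊥|  (equality of nets = componentwise equality of sets of chronicles)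
InAbsPerp : ∀ {β} → (Design β → Set) → Net (perp β) → Set₁
InAbsPerp {β} E R = Σ (Net (perp β)) λ R' → InPerp E R' ×
  (∀ i c → (chr (R i) c → AbsComp E R' i c) × (AbsComp E R' i c → chr (R i) c))

data HJ (p : List Action) (S : Seq) : Action → Set where
  hj-init : ∀ {a} → InitialIn S a → HJ p S a
  hj-step : ∀ {a b} → b ∈ p → JustBy a b → HJ p S b → HJ p S a

record IsPath (NB : List Seq) (p : List Action) : Set where
  field
    alt     : Alternating p
    dai     : DaimonLast p
    lin     : Linear p
    justif  : ∀ u κ r → p ≡ u ++ κ ∷ r → IsProper κ →
              InitialNet NB κ ⊎ (∃ λ b → b ∈ u × JustBy κ b)
    posView : ∀ u κ r → p ≡ u ++ κ ∷ r → IsProperPos κ → ¬ InitialNet NB κ →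
              ∃ λ b → b ∈ view u × pol b ≡ neg × JustBy κ b
    posInit : ∀ u κ r → p ≡ u ++ κ ∷ r → ∀ S → S ∈ NB → IsProperPos κ → InitialIn S κ →
              (u ≡ [] × left S ≡ nothing) ⊎
              (∃₂ λ u' b → u ≡ u' ++ b ∷ [] × pol b ≡ neg × HJ p S b)
    start   : Any (λ S → left S ≡ nothing) NB →
              ∃₂ λ κ r → p ≡ κ ∷ r × (κ ≡ daimon ⊎ (IsProperPos κ × InitialNet NB κ))

InP : ∀ {β} → Design β → List Action → Set
InP {β} D p = IsPath (β ∷ []) p × (∀ u v → p ≡ u ++ v → u ≢ [] → chr D (view u))

record PathCoh (p₁ p₂ : List Action) : Set where
  field
    first   : ∀ a₁ r₁ a₂ r₂ → p₁ ≡ a₁ ∷ r₁ → p₂ ≡ a₂ ∷ r₂ →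
              pol a₁ ≡ pol a₂ × (pol a₁ ≡ pos → a₁ ≡ a₂)
    posDet  : ∀ w₁ κ₁ r₁ w₂ κ₂ r₂ → p₁ ≡ w₁ ++ κ₁ ∷ r₁ → p₂ ≡ w₂ ++ κ₂ ∷ r₂ →
              pol κ₁ ≡ pos → pol κ₂ ≡ pos → view w₁ ≡ view w₂ → κ₁ ≡ κ₂
    negProp : ∀ w₁ κ₁ r₁ w₂ κ₂ r₂ → p₁ ≡ w₁ ++ κ₁ ∷ r₁ → p₂ ≡ w₂ ++ κ₂ ∷ r₂ →
              pol κ₁ ≡ neg → pol κ₂ ≡ neg →
              view (justPrefix w₁ κ₁) ≡ view (justPrefix w₂ κ₂) →
              DistinctFocus κ₁ κ₂ →
              ∀ x₁ σ₁ y₁ x₂ σ₂ y₂ → r₁ ≡ x₁ ++ σ₁ ∷ y₁ → r₂ ≡ x₂ ++ σ₂ ∷ y₂ →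
              κ₁ ∈ view (w₁ ++ κ₁ ∷ x₁ ++ σ₁ ∷ []) →
              κ₂ ∈ view (w₂ ++ κ₂ ∷ x₂ ++ σ₂ ∷ []) →
              DistinctFocus σ₁ σ₂

Clique : (List Action → Set₁) → (List Action → Set₁) → Set₁
Clique X Y = (∀ q → Y q → X q) × (∀ q₁ q₂ → Y q₁ → Y q₂ → PathCoh q₁ q₂)

Ctilde : (List Action → Set₁) → List Action → Set₁
Ctilde C q = ∃ λ p → C p × q ≡ tilde p

ViewsEq : ∀ (NB : List Seq) → (List Action → Set₁) → Net NB → Set₁
ViewsEq NB Y R = (∀ i c → chr (R i) c → ∃ λ q → Y q × ViewOfPrefix q c) ×
              (∀ c → (∃ λ q → Y q × ViewOfPrefix q c) → RMem NB R c)

{-# OPTIONS --safe #-}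
-- Take R′ ∈ E^⊥ with |R′|_{E^⊥} = R and let C be the set of interaction sequences ⟨D ← R′⟩, D ∈ E.
-- Each of them is a path of D: its positive actions are read in D and its negative ones in R′ at
-- the current views, and two actions on one focus would yield two incompatible chronicles of D or
-- of a single component of R′, or a locus strictly above a locus of the base.  Dually, the views of
-- prefixes of ⟨R′ ← D⟩ = ⟨D ← R′⟩~ are chronicles of R′, which gives ⌜C̃*⌝ = |R′| = R; and two
-- such sequences are coherent paths because the coherence of the chronicles of each design of R′
-- transfers to them, the disjointness of the base loci putting the chronicles involved into the
-- same component.
module Submission where

open import Defs
open import Data.Bool using (true; false; _∧_; T)
open import Data.Bool.Properties using (T-∧)
open import Data.Empty using (⊥; ⊥-elim)
open import Data.List
  using (List; []; _∷_; initLast; _∷ʳ′_; _++_; _∷ʳ_; [_]; map; reverse; concatMap; length; lookup)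
open import Data.List.Properties
  using (++-assoc; ++-cancelˡ; ++-identityʳ; ++-identityʳ-unique; ++-conicalʳ; ∷-injective; ∷ʳ-injective;
         map-++; unfold-reverse; reverse-++; reverse-involutive)
open import Data.List.Membership.Propositional using (_∈_; _∉_)
open import Data.List.Membership.Propositional.Properties
  using (∈-∃++; ∈-map⁻; ∈-++⁻; ∈-++⁺ˡ; ∈-++⁺ʳ)
open import Data.List.Relation.Unary.Any using (Any; here; there)
open import Data.List.Relation.Unary.Any.Properties using (reverse⁻; singleton⁻)
open import Data.List.Reverse using (Reverse; reverseView; []; _∶_∶ʳ_)
open import Data.Maybe using (just; nothing)
open import Data.Maybe.Properties using (just-injective)
open import Data.Nat using (ℕ; _≡ᵇ_)
open import Data.Nat.Properties using (≡ᵇ⇒≡)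
open import Data.Fin using (Fin; zero; suc)
open import Data.Product using (Σ; ∃; ∃₂; _×_; _,_; proj₁; proj₂)
open import Data.Sum using (_⊎_; inj₁; inj₂)
open import Function using (Equivalence)
open import Relation.Binary.PropositionalEquality
  using (_≡_; _≢_; refl; sym; trans; cong; cong₂; subst; module ≡-Reasoning)
open import Relation.Nullary using (¬_)

module _ {A : Set} where

  ++∷≢[] : ∀ (u : List A) x r → u ++ x ∷ r ≢ []
  ++∷≢[] u x r e with ++-conicalʳ u (x ∷ r) e
  ... | ()

  ≢[]⇒∷ʳ : ∀ (xs : List A) → xs ≢ [] → ∃₂ λ ys y → xs ≡ ys ∷ʳ y
  ≢[]⇒∷ʳ []           ne = ⊥-elim (ne refl)
  ≢[]⇒∷ʳ (x ∷ [])     ne = [] , x , refl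
  ≢[]⇒∷ʳ (x ∷ y ∷ xs) ne with ≢[]⇒∷ʳ (y ∷ xs) (λ ())
  ... | ys , z , e = x ∷ ys , z , cong (x ∷_) e

  ∷ʳ≡++∷-split : ∀ (xs ys : List A) κ a r → xs ∷ʳ κ ≡ ys ++ a ∷ r →
                 (r ≡ [] × xs ≡ ys × κ ≡ a) ⊎ (∃ λ r' → r ≡ r' ∷ʳ κ × xs ≡ ys ++ a ∷ r')
  ∷ʳ≡++∷-split []       []       κ a r refl = inj₁ (refl , refl , refl)
  ∷ʳ≡++∷-split []       (y ∷ ys) κ a r e  = ⊥-elim (++∷≢[] ys a r (sym (proj₂ (∷-injective e))))
  ∷ʳ≡++∷-split (x ∷ xs) []       κ a r e with ∷-injective e
  ... | refl , e' = inj₂ (xs , sym e' , refl)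
  ∷ʳ≡++∷-split (x ∷ xs) (y ∷ ys) κ a r e with ∷-injective e
  ... | refl , e' with ∷ʳ≡++∷-split xs ys κ a r e'
  ... | inj₁ (r≡[] , xs≡ys , κ≡a) = inj₁ (r≡[] , cong (x ∷_) xs≡ys , κ≡a)
  ... | inj₂ (r' , r≡ , xs≡)      = inj₂ (r' , r≡ , cong (x ∷_) xs≡)

  last∈suffix : ∀ (xs ys : List A) a k r → xs ∷ʳ a ≡ ys ++ k ∷ r → a ∈ k ∷ r
  last∈suffix xs ys a k r e with ∷ʳ≡++∷-split xs ys a k r e
  ... | inj₁ (refl , _ , refl) = here refl
  ... | inj₂ (r' , refl , _)   = there (∈-++⁺ʳ r' (here refl))

  ++-prefixes-comparable : ∀ (xs s ys t : List A) → xs ++ s ≡ ys ++ t →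
                           (∃ λ u → ys ≡ xs ++ u) ⊎ (∃ λ u → xs ≡ ys ++ u)
  ++-prefixes-comparable []       s ys       t e = inj₁ (ys , refl)
  ++-prefixes-comparable (x ∷ xs) s []       t e = inj₂ (x ∷ xs , refl)
  ++-prefixes-comparable (x ∷ xs) s (y ∷ ys) t e with ∷-injective e
  ... | refl , e' with ++-prefixes-comparable xs s ys t e'
  ... | inj₁ (u , p) = inj₁ (u , cong (x ∷_) p)
  ... | inj₂ (u , p) = inj₂ (u , cong (x ∷_) p)

  ∷ʳ-same-init-split : ∀ (xs w : List A) a b k₁ k₂ r₁ r₂ → xs ∷ʳ a ≡ w ++ k₁ ∷ r₁ →
                       xs ∷ʳ b ≡ w ++ k₂ ∷ r₂ → k₁ ≡ k₂ ⊎ (k₁ ≡ a × k₂ ≡ b)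
  ∷ʳ-same-init-split []       []      a b k₁ k₂ r₁ r₂ refl refl = inj₂ (refl , refl)
  ∷ʳ-same-init-split []       (y ∷ w) a b k₁ k₂ r₁ r₂ e₁ e₂ =
    ⊥-elim (++∷≢[] w k₁ r₁ (sym (proj₂ (∷-injective e₁))))
  ∷ʳ-same-init-split (x ∷ xs) []      a b k₁ k₂ r₁ r₂ e₁ e₂ =
    inj₁ (trans (sym (proj₁ (∷-injective e₁))) (proj₁ (∷-injective e₂)))
  ∷ʳ-same-init-split (x ∷ xs) (y ∷ w) a b k₁ k₂ r₁ r₂ e₁ e₂ =
    ∷ʳ-same-init-split xs w a b k₁ k₂ r₁ r₂ (proj₂ (∷-injective e₁)) (proj₂ (∷-injective e₂))

  ++∷-refine : ∀ {p u r u₁ u₂ : List A} {κ a : A} → p ≡ u ++ κ ∷ r → u ≡ u₁ ++ a ∷ u₂ →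
               p ≡ u₁ ++ a ∷ u₂ ++ κ ∷ r
  ++∷-refine {u₁ = u₁} {u₂ = u₂} {a = a} e refl = trans e (++-assoc u₁ (a ∷ u₂) _)

  ++∷-∷ʳ-++ : ∀ (w : List A) κ x σ y → (w ++ κ ∷ x ∷ʳ σ) ++ y ≡ w ++ κ ∷ x ++ σ ∷ y
  ++∷-∷ʳ-++ w κ x σ y =
    trans (++-assoc w (κ ∷ x ∷ʳ σ) y) (cong (λ z → w ++ κ ∷ z) (++-assoc x [ σ ] y))

  ++∷⇒∈ : ∀ {x : A} {u v p} → p ≡ u ++ x ∷ v → x ∈ p
  ++∷⇒∈ {u = u} refl = ∈-++⁺ʳ u (here refl)

  ∈-prefix-of : ∀ {x : A} {u v p} → p ≡ u ++ v → x ∈ u → x ∈ p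
  ∈-prefix-of refl m = ∈-++⁺ˡ m

opp-involutive : ∀ e → opp (opp e) ≡ e
opp-involutive pos = refl
opp-involutive neg = refl

dualA-involutive : ∀ x → dualA (dualA x) ≡ x
dualA-involutive daimon      = refl
dualA-involutive (act e ξ I) = cong (λ e' → act e' ξ I) (opp-involutive e)

dualSeq-involutive : ∀ l → dualSeq (dualSeq l) ≡ l
dualSeq-involutive []      = refl
dualSeq-involutive (x ∷ l) = cong₂ _∷_ (dualA-involutive x) (dualSeq-involutive l)

dualSeq-++ : ∀ l m → dualSeq (l ++ m) ≡ dualSeq l ++ dualSeq m
dualSeq-++ = map-++ dualA

dualSeq-split : ∀ l u v → dualSeq l ≡ u ++ v → l ≡ dualSeq u ++ dualSeq v
dualSeq-split l u v e = trans (sym (dualSeq-involutive l)) (trans (cong dualSeq e) (dualSeq-++ u v))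

focus-dualA : ∀ x → focus (dualA x) ≡ focus x
focus-dualA daimon      = refl
focus-dualA (act e ξ I) = refl

pol-dualA-neg : ∀ x → pol x ≡ neg → pol (dualA x) ≡ pos
pol-dualA-neg (act neg ξ I) _ = refl

pol-dualA-pos : ∀ x → pol x ≡ pos → x ≢ daimon → pol (dualA x) ≡ neg
pol-dualA-pos daimon        _ ne = ⊥-elim (ne refl)
pol-dualA-pos (act pos ξ I) _ _  = refl

pol-dualA⁻-neg : ∀ x → pol (dualA x) ≡ neg → pol x ≡ pos
pol-dualA⁻-neg (act pos ξ I) _ = refl

oppB-opp : ∀ a b → oppB (opp a) (opp b) ≡ oppB a b
oppB-opp pos pos = refl
oppB-opp pos neg = refl
oppB-opp neg pos = refl
oppB-opp neg neg = refl

justB-dualA : ∀ b a → justB (dualA b) (dualA a) ≡ justB b a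
justB-dualA daimon        _            = refl
justB-dualA (act e ξ I)   daimon       = refl
justB-dualA (act e₂ ξ I)  (act e₁ ζ J) with childIdx ξ ζ
... | nothing = refl
... | just i  = cong (_∧ memB 0 i I) (oppB-opp e₁ e₂)

tilde-∷ : ∀ a r → r ≢ [] → tilde (a ∷ r) ≡ dualA a ∷ tilde r
tilde-∷ a           []      ne = ⊥-elim (ne refl)
tilde-∷ daimon      (x ∷ r) ne = refl
tilde-∷ (act e ξ I) (x ∷ r) ne = refl

tilde-∷ʳ-daimon : ∀ w → tilde (w ∷ʳ daimon) ≡ dualSeq w
tilde-∷ʳ-daimon []      = refl
tilde-∷ʳ-daimon (a ∷ w) =
  trans (tilde-∷ a (w ∷ʳ daimon) (++∷≢[] w daimon [])) (cong (dualA a ∷_) (tilde-∷ʳ-daimon w))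

tilde-daimon-free : ∀ w → daimon ∉ w → tilde w ≡ dualSeq w ∷ʳ daimon
tilde-daimon-free []               nd = refl
tilde-daimon-free (daimon ∷ [])    nd = ⊥-elim (nd (here refl))
tilde-daimon-free (act e ξ I ∷ []) nd = refl
tilde-daimon-free (a ∷ b ∷ w)      nd =
  trans (tilde-∷ a (b ∷ w) (λ ())) (cong (dualA a ∷_) (tilde-daimon-free (b ∷ w) (λ m → nd (there m))))

daimon∉dualSeq : ∀ l → daimon ∉ l → daimon ∉ dualSeq l
daimon∉dualSeq l nd m with ∈-map⁻ dualA m
... | daimon , m' , _ = nd m'

-- Views

mutual
  viewR⊆ : ∀ {x} l → x ∈ viewR l → x ∈ l
  viewR⊆ (κ ∷ rw) m = viewStep⊆ (pol κ) κ rw m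

  viewStep⊆ : ∀ {x} e κ rw → x ∈ viewStep e κ rw → x ∈ κ ∷ rw
  viewStep⊆ pos κ rw (here p)  = here p
  viewStep⊆ pos κ rw (there m) = there (viewR⊆ rw m)
  viewStep⊆ neg κ rw (here p)  = here p
  viewStep⊆ neg κ rw (there m) = there (seekR⊆ κ rw m)

  seekR⊆ : ∀ {x} κ rw → x ∈ seekR κ rw → x ∈ rw
  seekR⊆ κ (b ∷ rw) m = seekStep⊆ (justB b κ) κ (b ∷ rw) m

  seekStep⊆ : ∀ {x} j κ l → x ∈ seekStep j κ l → x ∈ l
  seekStep⊆ true  κ l        m = viewR⊆ l m
  seekStep⊆ false κ (b ∷ rw) m = there (seekR⊆ κ rw m)

view⊆ : ∀ {x} u → x ∈ view u → x ∈ u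
view⊆ u m = reverse⁻ (viewR⊆ (reverse u) (reverse⁻ m))

view-∷ʳ-pos : ∀ u κ → pol κ ≡ pos → view (u ∷ʳ κ) ≡ view u ∷ʳ κ
view-∷ʳ-pos u κ p rewrite reverse-++ u [ κ ] | p = unfold-reverse κ (viewR (reverse u))

view-dualSeq-∷ʳ-neg : ∀ u κ → pol κ ≡ neg → view (dualSeq (u ∷ʳ κ)) ≡ view (dualSeq u) ∷ʳ dualA κ
view-dualSeq-∷ʳ-neg u κ p =
  trans (cong view (dualSeq-++ u [ κ ])) (view-∷ʳ-pos (dualSeq u) (dualA κ) (pol-dualA-neg κ p))

seekR≡viewR-seekJ : ∀ κ rw → seekR κ rw ≡ viewR (seekJ κ rw)
seekR≡viewR-seekJ κ []       = refl
seekR≡viewR-seekJ κ (b ∷ rw) with justB b κ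
... | true  = refl
... | false = seekR≡viewR-seekJ κ rw

view-∷ʳ-neg : ∀ u κ → pol κ ≡ neg → view (u ∷ʳ κ) ≡ view (justPrefix u κ) ∷ʳ κ
view-∷ʳ-neg u κ p
  rewrite reverse-++ u [ κ ] | p | seekR≡viewR-seekJ κ (reverse u)
        | reverse-involutive (seekJ κ (reverse u))
  = unfold-reverse κ (viewR (seekJ κ (reverse u)))

viewStep-head : ∀ e κ rw → ∃ λ s → viewStep e κ rw ≡ κ ∷ s
viewStep-head pos κ rw = _ , refl
viewStep-head neg κ rw = _ , refl

view-∷ʳ : ∀ u κ → ∃ λ t → view (u ∷ʳ κ) ≡ t ∷ʳ κ
view-∷ʳ u κ rewrite reverse-++ u [ κ ] with viewStep-head (pol κ) κ (reverse u)
... | s , e rewrite e = reverse s , unfold-reverse κ s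

view-≢[] : ∀ u → u ≢ [] → view u ≢ []
view-≢[] u ne eq with ≢[]⇒∷ʳ u ne
... | ys , y , refl with view-∷ʳ ys y
... | t , e = ++∷≢[] t y [] (trans (sym e) eq)

view-[_] : ∀ x → view [ x ] ≡ [ x ]
view-[ daimon ]      = refl
view-[ act pos ξ I ] = refl
view-[ act neg ξ I ] = refl

-- A view that keeps κ has passed through κ, after which it proceeds as the view from κ.
mutual
  viewR-through : ∀ κ rm rn → κ ∉ rn → κ ∉ rm → κ ∈ viewR (rn ++ κ ∷ rm) →
                  ∃ λ t → viewR (rn ++ κ ∷ rm) ≡ t ++ viewR (κ ∷ rm)
  viewR-through κ rm []       _  _  _ = [] , refl
  viewR-through κ rm (y ∷ rn) n₁ n₂ m =
    viewStep-through κ rm (pol y) y rn (λ q → n₁ (there q)) (λ q → n₁ (here q)) n₂ m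

  viewStep-through : ∀ κ rm e y rn → κ ∉ rn → κ ≢ y → κ ∉ rm → κ ∈ viewStep e y (rn ++ κ ∷ rm) →
                     ∃ λ t → viewStep e y (rn ++ κ ∷ rm) ≡ t ++ viewR (κ ∷ rm)
  viewStep-through κ rm pos y rn n₁ ny n₂ (here p) = ⊥-elim (ny p)
  viewStep-through κ rm pos y rn n₁ ny n₂ (there m) with viewR-through κ rm rn n₁ n₂ m
  ... | t , e = y ∷ t , cong (y ∷_) e
  viewStep-through κ rm neg y rn n₁ ny n₂ (here p) = ⊥-elim (ny p)
  viewStep-through κ rm neg y rn n₁ ny n₂ (there m) with seekR-through κ rm y rn n₁ n₂ m
  ... | t , e = y ∷ t , cong (y ∷_) e

  seekR-through : ∀ κ rm y rn → κ ∉ rn → κ ∉ rm → κ ∈ seekR y (rn ++ κ ∷ rm) →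
                  ∃ λ t → seekR y (rn ++ κ ∷ rm) ≡ t ++ viewR (κ ∷ rm)
  seekR-through κ rm y []       n₁ n₂ m = seekStep-at κ rm y (justB κ y) n₂ m
  seekR-through κ rm y (b ∷ rn) n₁ n₂ m = seekStep-through κ rm y (justB b y) (b ∷ rn) n₁ n₂ m

  seekStep-at : ∀ κ rm y j → κ ∉ rm → κ ∈ seekStep j y (κ ∷ rm) →
                ∃ λ t → seekStep j y (κ ∷ rm) ≡ t ++ viewR (κ ∷ rm)
  seekStep-at κ rm y true  n₂ m = [] , refl
  seekStep-at κ rm y false n₂ m = ⊥-elim (n₂ (seekR⊆ y rm m))

  seekStep-through : ∀ κ rm y j l → κ ∉ l → κ ∉ rm → κ ∈ seekStep j y (l ++ κ ∷ rm) →
                     ∃ λ t → seekStep j y (l ++ κ ∷ rm) ≡ t ++ viewR (κ ∷ rm)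
  seekStep-through κ rm y true  l        n₁ n₂ m = viewR-through κ rm l n₁ n₂ m
  seekStep-through κ rm y false []       n₁ n₂ m = seekStep-at κ rm y false n₂ m
  seekStep-through κ rm y false (b ∷ rn) n₁ n₂ m = seekR-through κ rm y rn (λ q → n₁ (there q)) n₂ m

view-through : ∀ m κ n → κ ∉ m → κ ∉ n → κ ∈ view (m ++ κ ∷ n) →
               ∃ λ t → view (m ++ κ ∷ n) ≡ view (m ∷ʳ κ) ++ t
view-through m κ n n₁ n₂ k∈
  rewrite reverse-++ m (κ ∷ n) | unfold-reverse κ n | ++-assoc (reverse n) [ κ ] (reverse m)
        | reverse-++ m [ κ ]
  with viewR-through κ (reverse m) (reverse n) (λ q → n₂ (reverse⁻ q)) (λ q → n₁ (reverse⁻ q))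
                     (reverse⁻ k∈)
... | t , e rewrite e = reverse t , reverse-++ t (viewR (κ ∷ reverse m))

childIdx-sound : ∀ ξ ζ k → childIdx ξ ζ ≡ just k → ζ ≡ ξ ++ [ k ]
childIdx-sound []      (i ∷ [])  k refl = refl
childIdx-sound []      (i ∷ _ ∷ _) k ()
childIdx-sound (x ∷ ξ) (y ∷ ζ)   k e with x ≡ᵇ y in x≡ᵇy
... | true = cong₂ _∷_ (sym (≡ᵇ⇒≡ x y (subst T (sym x≡ᵇy) _))) (childIdx-sound ξ ζ k e)

oppB-sound : ∀ a b → T (oppB a b) → a ≡ opp b
oppB-sound pos neg _ = refl
oppB-sound neg pos _ = refl

record Justification (b a : Action) : Set where
  field
    locus           : Locus
    index           : ℕ
    focus-justifier : focus b ≡ just locus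
    focus-justified : focus a ≡ just (locus ∷ʳ index)
    pol-justified   : pol a ≡ opp (pol b)

justification : ∀ {a b} → JustBy a b → Justification b a
justification {act e₁ ζ J} {act e₂ ξ I} j with childIdx ξ ζ in eq
... | just k = record
  { locus = ξ ; index = k ; focus-justifier = refl
  ; focus-justified = cong just (childIdx-sound ξ ζ k eq)
  ; pol-justified   = oppB-sound e₁ e₂ (proj₁ (Equivalence.to T-∧ j)) }

focus⇒IsProper : ∀ {b ξ} → focus b ≡ just ξ → IsProper b
focus⇒IsProper {act e ξ I} _ = proper e ξ I

justifier-IsProper : ∀ {a b} → JustBy a b → IsProper b
justifier-IsProper j = focus⇒IsProper (Justification.focus-justifier (justification j))

DistinctFocus-sym : ∀ {a b} → DistinctFocus a b → DistinctFocus b a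
DistinctFocus-sym d ξ p q = d ξ q p

Linear-tail : ∀ x l → Linear (x ∷ l) → Linear l
Linear-tail x l L u κ v κ' r e = L (x ∷ u) κ v κ' r (cong (x ∷_) e)

Linear-prefix : ∀ l m → Linear (l ++ m) → Linear l
Linear-prefix l m L u κ v κ' r refl =
  L u κ v κ' (r ++ m) (trans (++-assoc u _ m) (cong (λ z → u ++ κ ∷ z) (++-assoc v (κ' ∷ r) m)))

Linear⇒DistinctFocus : ∀ l → Linear l → ∀ {x y} → x ∈ l → y ∈ l → x ≢ y → DistinctFocus x y
Linear⇒DistinctFocus (z ∷ l) L (here refl) (here refl) ne = ⊥-elim (ne refl)
Linear⇒DistinctFocus (z ∷ l) L (here refl) (there q)   ne with ∈-∃++ q
... | m , n , refl = L [] z m _ n refl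
Linear⇒DistinctFocus (z ∷ l) L (there p)   (here refl) ne with ∈-∃++ p
... | m , n , refl = DistinctFocus-sym (L [] z m _ n refl)
Linear⇒DistinctFocus (z ∷ l) L (there p)   (there q)   ne =
  Linear⇒DistinctFocus l (Linear-tail z l L) p q ne

Linear-∷ʳ : ∀ l κ → Linear l → (∀ a → a ∈ l → DistinctFocus a κ) → Linear (l ∷ʳ κ)
Linear-∷ʳ l κ L new u a v a' r e
  with ∷ʳ≡++∷-split l (u ++ a ∷ v) κ a' r (trans e (sym (++-assoc u (a ∷ v) (a' ∷ r))))
... | inj₁ (refl , refl , refl) = new a (∈-++⁺ʳ u (here refl))
... | inj₂ (r' , refl , e')     = L u a v a' r' (trans e' (++-assoc u (a ∷ v) (a' ∷ r')))

Linear-dualSeq : ∀ l → Linear l → Linear (dualSeq l)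
Linear-dualSeq l L u κ v κ' r e ξ p q =
  L (dualSeq u) (dualA κ) (dualSeq v) (dualA κ') (dualSeq r) l≡ ξ
    (trans (focus-dualA κ) p) (trans (focus-dualA κ') q)
  where
  l≡ : l ≡ dualSeq u ++ dualA κ ∷ dualSeq v ++ dualA κ' ∷ dualSeq r
  l≡ = trans (dualSeq-split l u (κ ∷ v ++ κ' ∷ r) e)
             (cong (λ z → dualSeq u ++ dualA κ ∷ z) (dualSeq-++ v (κ' ∷ r)))

Linear⇒occurs-once : ∀ m κ n ζ → Linear (m ++ κ ∷ n) → focus κ ≡ just ζ → κ ∉ m × κ ∉ n
Linear⇒occurs-once m κ n ζ L f = ∉m , ∉n
  where
  ∉m : κ ∉ m
  ∉m p with ∈-∃++ p
  ... | m₁ , m₂ , refl = L m₁ κ m₂ κ n (++-assoc m₁ (κ ∷ m₂) (κ ∷ n)) ζ f f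
  ∉n : κ ∉ n
  ∉n p with ∈-∃++ p
  ... | n₁ , n₂ , refl = L m κ n₁ κ n₂ refl ζ f f

view-strict-prefix≢ : ∀ L L₁ a L₂ → L ≡ L₁ ++ a ∷ L₂ → Linear L → daimon ∉ L → view L₁ ≢ view L
view-strict-prefix≢ L [] a L₂ refl _ _ eq = view-≢[] L (++∷≢[] [] a L₂) (sym eq)
view-strict-prefix≢ L (l ∷ L₁) a L₂ L≡ Lin nd eq
  with ≢[]⇒∷ʳ (l ∷ L₁) (λ ()) | ≢[]⇒∷ʳ (a ∷ L₂) (λ ())
... | L₁' , x , e₁ | M , y , e₂ with view-∷ʳ L₁' x | view-∷ʳ (L₁' ++ x ∷ M) y
... | t₁ , v₁ | t , v₂ = last-differs x refl
  where
  L≡' : L ≡ L₁' ++ x ∷ M ∷ʳ y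
  L≡' = trans L≡ (trans (cong₂ _++_ e₁ e₂) (++-assoc L₁' [ x ] (M ∷ʳ y)))
  x≡y : x ≡ y
  x≡y = proj₂ (∷ʳ-injective t₁ t (trans (sym v₁) (trans (cong view (sym e₁))
          (trans eq (trans (cong view (trans L≡' (sym (++-assoc L₁' (x ∷ M) [ y ])))) v₂)))))
  last-differs : ∀ z → z ≡ x → ⊥
  last-differs daimon      refl = nd (subst (daimon ∈_) (sym L≡') (∈-++⁺ʳ L₁' (here refl)))
  last-differs (act ε ξ I) refl = Lin L₁' x M y [] L≡' ξ refl (cong focus (sym x≡y))

PrefixClosed : (List Action → Set) → Set
PrefixClosed P = ∀ u v → P (u ++ v) → u ≢ [] → P u

RMem-PrefixClosed : ∀ NB (R : Net NB) → PrefixClosed (RMem NB R)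
RMem-PrefixClosed NB R u v (i , h) ne = i , prefixCl (R i) u v h ne

-- Views ending with a negative action are prefixes of the view at the positive action that follows.
prefix-views : ∀ {P} → PrefixClosed P → ∀ s →
               (∀ u κ r → s ≡ u ++ κ ∷ r → pol κ ≡ pos → P (view (u ∷ʳ κ))) →
               (∀ u κ r → s ≡ u ++ κ ∷ r → pol κ ≡ neg → ∃₂ λ κ' r' → r ≡ κ' ∷ r' × pol κ' ≡ pos) →
               ∀ u v → s ≡ u ++ v → u ≢ [] → P (view u)
prefix-views {P} closed s at-pos neg-next u v s≡ ne with ≢[]⇒∷ʳ u ne
... | u' , κ , refl with pol κ in pκ
... | pos = at-pos u' κ v (trans s≡ (++-assoc u' [ κ ] v)) pκ
... | neg with neg-next u' κ v (trans s≡ (++-assoc u' [ κ ] v)) pκ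
... | κ' , v' , refl , pκ' =
  closed (view (u' ∷ʳ κ)) [ κ' ]
    (subst P (view-∷ʳ-pos (u' ∷ʳ κ) κ' pκ') (at-pos (u' ∷ʳ κ) κ' v' s≡ pκ'))
    (view-≢[] (u' ∷ʳ κ) ne)

-- Hereditary justification

Justified : Seq → List Action → Set
Justified S p = ∀ u y r → p ≡ u ++ y ∷ r → IsProper y → InitialIn S y ⊎ ∃ λ b → b ∈ u × JustBy y b

Justified⇒HJ : ∀ {S p} → Justified S p → ∀ {y} → y ∈ p → IsProper y → HJ p S y
Justified⇒HJ {S} {p} J m = prefixHJ p (reverseView p) ([] , sym (++-identityʳ p)) m
  where
  prefixHJ : ∀ u → Reverse u → (∃ λ r → p ≡ u ++ r) → ∀ {y} → y ∈ u → IsProper y → HJ p S y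
  prefixHJ .(xs ∷ʳ x) (xs ∶ rs ∶ʳ x) (r , p≡) m pr with ∈-++⁻ xs m
  ... | inj₁ m' = prefixHJ xs rs (x ∷ r , trans p≡ (++-assoc xs [ x ] r)) m' pr
  ... | inj₂ (here refl) with J xs x r (trans p≡ (++-assoc xs [ x ] r)) pr
  ...   | inj₁ i            = hj-init i
  ...   | inj₂ (b , b∈ , j) =
    hj-step (∈-prefix-of p≡ (∈-++⁺ˡ b∈)) j
            (prefixHJ xs rs (x ∷ r , trans p≡ (++-assoc xs [ x ] r)) b∈ (justifier-IsProper j))

Chronicle⇒Justified : ∀ {S c} → Chronicle S c → Justified S c
Chronicle⇒Justified ch u (act neg ξ I) r e _ with Chronicle.negJ ch u (act neg ξ I) r e refl
... | inj₁ (_ , i)              = inj₁ i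
... | inj₂ (u' , b , refl , j)  = inj₂ (b , ∈-++⁺ʳ u' (here refl) , j)
Chronicle⇒Justified ch u (act pos ξ I) r e _ = Chronicle.posJ ch u (act pos ξ I) r e (properPos ξ I)

ExtendsSome : List Locus → Locus → Set
ExtendsSome L ζ = ∃ λ ζ₀ → ζ₀ ∈ L × ∃ λ s → ζ ≡ ζ₀ ++ s

initial-focus∈lociOf : ∀ S y ζ → InitialIn S y → focus y ≡ just ζ → ζ ∈ lociOf S
initial-focus∈lociOf S             (act pos ξ I) ζ i    refl = ∈-++⁺ʳ (maybeList (left S)) i
initial-focus∈lociOf (just x ⊢ Δ)  (act neg ξ I) ζ refl refl = here refl

HJ⇒ExtendsSome : ∀ {p S y ζ} → HJ p S y → focus y ≡ just ζ → ExtendsSome (lociOf S) ζ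
HJ⇒ExtendsSome {S = S} {y} {ζ} (hj-init i) f =
  ζ , initial-focus∈lociOf S y ζ i f , [] , sym (++-identityʳ ζ)
HJ⇒ExtendsSome (hj-step _ j h) f with justification j
... | record { locus = ξ ; index = k ; focus-justifier = fb ; focus-justified = fa }
    with HJ⇒ExtendsSome h fb
... | ζ₀ , m , s , refl =
  ζ₀ , m , s ∷ʳ k , trans (just-injective (trans (sym f) fa)) (++-assoc ζ₀ s [ k ])

Justified⇒ExtendsSome : ∀ {S p} → Justified S p → ∀ {y ζ} → y ∈ p → focus y ≡ just ζ →
                        ExtendsSome (lociOf S) ζ
Justified⇒ExtendsSome J m f = HJ⇒ExtendsSome (Justified⇒HJ J m (focus⇒IsProper f)) f

PairwiseDisjoint : List Locus → Set
PairwiseDisjoint L = ∀ w ξ u ζ r → L ≡ w ++ ξ ∷ u ++ ζ ∷ r → DisjointLoci ξ ζ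

PairwiseDisjoint-tail : ∀ x L → PairwiseDisjoint (x ∷ L) → PairwiseDisjoint L
PairwiseDisjoint-tail x L D w ξ u ζ r e = D (x ∷ w) ξ u ζ r (cong (x ∷_) e)

PairwiseDisjoint-head : ∀ x L → PairwiseDisjoint (x ∷ L) → ∀ {ζ} → ζ ∈ L → DisjointLoci x ζ
PairwiseDisjoint-head x L D p with ∈-∃++ p
... | m , n , refl = D [] x m _ n refl

PairwiseDisjoint-head∉ : ∀ x L → PairwiseDisjoint (x ∷ L) → x ∉ L
PairwiseDisjoint-head∉ x L D p = proj₁ (PairwiseDisjoint-head x L D p) ([] , sym (++-identityʳ x))

prefix⇒≡ : ∀ L → PairwiseDisjoint L → ∀ {ζ₁ ζ₂} → ζ₁ ∈ L → ζ₂ ∈ L →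
           (∃ λ s → ζ₂ ≡ ζ₁ ++ s) → ζ₁ ≡ ζ₂
prefix⇒≡ (x ∷ L) D (here refl) (here refl) _ = refl
prefix⇒≡ (x ∷ L) D (here refl) (there q)   ex = ⊥-elim (proj₁ (PairwiseDisjoint-head x L D q) ex)
prefix⇒≡ (x ∷ L) D (there p)   (here refl) ex = ⊥-elim (proj₂ (PairwiseDisjoint-head x L D p) ex)
prefix⇒≡ (x ∷ L) D (there p)   (there q)   ex = prefix⇒≡ L (PairwiseDisjoint-tail x L D) p q ex

common-extension⇒≡ : ∀ L → PairwiseDisjoint L → ∀ {ζ ζ₁ ζ₂ s₁ s₂} → ζ₁ ∈ L → ζ₂ ∈ L →
                     ζ ≡ ζ₁ ++ s₁ → ζ ≡ ζ₂ ++ s₂ → ζ₁ ≡ ζ₂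
common-extension⇒≡ L D {ζ₁ = ζ₁} {ζ₂} {s₁} {s₂} p q refl e
  with ++-prefixes-comparable ζ₁ s₁ ζ₂ s₂ e
... | inj₁ ex = prefix⇒≡ L D p q ex
... | inj₂ ex = sym (prefix⇒≡ L D q p ex)

¬strict-extension : ∀ L → PairwiseDisjoint L → ∀ {ζ₁ ζ₂} s k → ζ₁ ∈ L → ζ₂ ∈ L →
                    ζ₂ ≢ ζ₁ ++ s ∷ʳ k
¬strict-extension L D {ζ₁} s k p q e with prefix⇒≡ L D p q (s ∷ʳ k , e)
... | refl = ++∷≢[] s k [] (++-identityʳ-unique ζ₁ e)

PairwiseDisjoint-++ʳ : ∀ L M → PairwiseDisjoint (L ++ M) → PairwiseDisjoint M
PairwiseDisjoint-++ʳ L M D w ξ u ζ r e = D (L ++ w) ξ u ζ r (trans (cong (L ++_) e) (sym (++-assoc L w _)))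

PairwiseDisjoint-++⇒∉ : ∀ L M → PairwiseDisjoint (L ++ M) → ∀ {ζ} → ζ ∈ L → ζ ∉ M
PairwiseDisjoint-++⇒∉ L M D {ζ} p q with ∈-∃++ p | ∈-∃++ q
... | a , b , refl | c , d , refl =
  proj₁ (D a ζ (b ++ c) ζ d
           (trans (++-assoc a (ζ ∷ b) _) (cong (λ z → a ++ ζ ∷ z) (sym (++-assoc b c _)))))
        ([] , sym (++-identityʳ ζ))

-- Components of β^⊥

∈-lociOf-lookup⇒∈-concatMap : ∀ NB (i : Fin (length NB)) {ζ} → ζ ∈ lociOf (lookup NB i) →
                              ζ ∈ concatMap lociOf NB
∈-lociOf-lookup⇒∈-concatMap (S ∷ NB) zero    m = ∈-++⁺ˡ m
∈-lociOf-lookup⇒∈-concatMap (S ∷ NB) (suc i) m = ∈-++⁺ʳ (lociOf S) (∈-lociOf-lookup⇒∈-concatMap NB i m)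

lociOf-lookup-injective : ∀ NB → PairwiseDisjoint (concatMap lociOf NB) → ∀ i j {ζ} →
                          ζ ∈ lociOf (lookup NB i) → ζ ∈ lociOf (lookup NB j) → i ≡ j
lociOf-lookup-injective (S ∷ NB) D zero    zero    p q = refl
lociOf-lookup-injective (S ∷ NB) D zero    (suc j) p q =
  ⊥-elim (PairwiseDisjoint-++⇒∉ (lociOf S) _ D p (∈-lociOf-lookup⇒∈-concatMap NB j q))
lociOf-lookup-injective (S ∷ NB) D (suc i) zero    p q =
  ⊥-elim (PairwiseDisjoint-++⇒∉ (lociOf S) _ D q (∈-lociOf-lookup⇒∈-concatMap NB i p))
lociOf-lookup-injective (S ∷ NB) D (suc i) (suc j) p q =
  cong suc (lociOf-lookup-injective NB (PairwiseDisjoint-++ʳ (lociOf S) _ D) i j p q)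

negSeq : Locus → Seq
negSeq σ = just σ ⊢ []

concatMap-lociOf-perp : ∀ β → concatMap lociOf (perp β) ≡ lociOf β
concatMap-lociOf-perp (nothing ⊢ Δ) = negSeqs Δ
  where
  negSeqs : ∀ Δ → concatMap lociOf (map negSeq Δ) ≡ Δ
  negSeqs []      = refl
  negSeqs (σ ∷ Δ) = cong (σ ∷_) (negSeqs Δ)
concatMap-lociOf-perp (just ξ ⊢ Δ) = cong (ξ ∷_) (concatMap-lociOf-perp (nothing ⊢ Δ))

data Component (β : Seq) (i : Fin (length (perp β))) : Set where
  positive : ∀ ξ → left β ≡ just ξ → lookup (perp β) i ≡ (nothing ⊢ (ξ ∷ [])) → Component β i
  negative : ∀ σ → σ ∈ right β → lookup (perp β) i ≡ negSeq σ → Component β i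

lookup-map-negSeq : ∀ Δ (i : Fin (length (map negSeq Δ))) →
                    ∃ λ σ → σ ∈ Δ × lookup (map negSeq Δ) i ≡ negSeq σ
lookup-map-negSeq (σ ∷ Δ) zero    = σ , here refl , refl
lookup-map-negSeq (σ ∷ Δ) (suc i) with lookup-map-negSeq Δ i
... | σ' , m , e = σ' , there m , e

component : ∀ β i → Component β i
component (just ξ ⊢ Δ) zero = positive ξ refl refl
component (just ξ ⊢ Δ) (suc i) with lookup-map-negSeq Δ i
... | σ , m , e = negative σ m e
component (nothing ⊢ Δ) i with lookup-map-negSeq Δ i
... | σ , m , e = negative σ m e

Chronicle-pos-head⇒left≡nothing : ∀ {S x r} → Chronicle S (x ∷ r) → pol x ≡ pos → left S ≡ nothing
Chronicle-pos-head⇒left≡nothing {nothing ⊢ Δ} ch p = refl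
Chronicle-pos-head⇒left≡nothing {just ξ ⊢ Δ} {x} {r} ch p
  with trans (sym p) (Chronicle.negBase ch ξ refl x r refl)
... | ()

right-component⇒left : ∀ β i {ζ} → ζ ∈ right (lookup (perp β) i) → left β ≡ just ζ
right-component⇒left β i m with component β i
... | positive ξ e e' rewrite e' | e = cong just (sym (singleton⁻ m))
... | negative σ _ e' rewrite e' with m
... | ()

left≡nothing⇒components-negative : ∀ β → left β ≡ nothing → ∀ i →
                                    ∃ λ σ → left (lookup (perp β) i) ≡ just σ
left≡nothing⇒components-negative β ln i with component β i
... | positive ξ e _ with trans (sym ln) e
... | ()
left≡nothing⇒components-negative β ln i | negative σ _ e' rewrite e' = σ , refl

module _ {β : Seq} (W : WFBase β) where

  perp-PairwiseDisjoint : PairwiseDisjoint (concatMap lociOf (perp β))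
  perp-PairwiseDisjoint = subst PairwiseDisjoint (sym (concatMap-lociOf-perp β)) W

  positive-component-unique : ∀ i j → left (lookup (perp β) i) ≡ nothing →
                              left (lookup (perp β) j) ≡ nothing → i ≡ j
  positive-component-unique i j li lj with component β i | component β j
  ... | positive ξ e e' | positive ξ' f f' with trans (sym e) f
  ... | refl = lociOf-lookup-injective (perp β) perp-PairwiseDisjoint i j
                 (subst (λ S → ξ ∈ lociOf S) (sym e') (here refl))
                 (subst (λ S → ξ ∈ lociOf S) (sym f') (here refl))
  positive-component-unique i j li lj | negative _ _ e' | _ rewrite e' with li
  ... | ()
  positive-component-unique i j li lj | positive _ _ _ | negative _ _ f' rewrite f' with lj
  ... | ()

  -- Every focus of a chronicle of a component lies above a locus of that component, and these
  -- loci are pairwise disjoint across components.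
  focus-component-unique : (R : Net (perp β)) → ∀ i j {c₁ c₂} → chr (R i) c₁ → chr (R j) c₂ →
                           ∀ {y₁ y₂ ζ} → y₁ ∈ c₁ → y₂ ∈ c₂ → focus y₁ ≡ just ζ → focus y₂ ≡ just ζ →
                           i ≡ j
  focus-component-unique R i j h₁ h₂ m₁ m₂ f₁ f₂
    with Justified⇒ExtendsSome (Chronicle⇒Justified (isChron (R i) _ h₁)) m₁ f₁
       | Justified⇒ExtendsSome (Chronicle⇒Justified (isChron (R j) _ h₂)) m₂ f₂
  ... | ζ₀ , n₀ , _ , e₀ | ζ₁ , n₁ , _ , e₁
    with common-extension⇒≡ _ perp-PairwiseDisjoint
           (∈-lociOf-lookup⇒∈-concatMap (perp β) i n₀) (∈-lociOf-lookup⇒∈-concatMap (perp β) j n₁)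
           e₀ e₁
  ... | refl = lociOf-lookup-injective (perp β) perp-PairwiseDisjoint i j n₀ n₁

-- Coherence inside a design

design-pos-deterministic : ∀ {S} (X : Design S) c κ₁ κ₂ → chr X (c ∷ʳ κ₁) → chr X (c ∷ʳ κ₂) →
                           pol κ₁ ≡ pos → pol κ₂ ≡ pos → κ₁ ≡ κ₂
design-pos-deterministic X c κ₁ κ₂ h₁ h₂ p₁ p₂ with CohChron.diverge (coherent X _ _ h₁ h₂)
... | inj₁ (inj₁ (u , e)) = sym (proj₁ (∷-injective (++-cancelˡ c _ _ (trans e (++-assoc c [ κ₁ ] u)))))
... | inj₁ (inj₂ (u , e)) = proj₁ (∷-injective (++-cancelˡ c _ _ (trans e (++-assoc c [ κ₂ ] u))))
... | inj₂ (w , k₁ , r₁ , k₂ , r₂ , e₁ , e₂ , k₁≢k₂ , n₁ , _)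
    with ∷ʳ-same-init-split c w κ₁ κ₂ k₁ k₂ r₁ r₂ e₁ e₂
... | inj₁ k₁≡k₂       = ⊥-elim (k₁≢k₂ k₁≡k₂)
... | inj₂ (refl , _) with trans (sym p₁) n₁
... | ()

¬prefix-focus-clash : ∀ {S} (X : Design S) vA vK a k s → chr X (vK ∷ʳ k) → vK ∷ʳ k ≡ vA ++ a ∷ s →
                      vA ≢ vK → ¬ DistinctFocus a k → ⊥
¬prefix-focus-clash X vA vK a k [] h e vA≢vK _ = vA≢vK (sym (proj₁ (∷ʳ-injective vK vA e)))
¬prefix-focus-clash X vA vK a k (s₀ ∷ s) h e _ ¬df with ≢[]⇒∷ʳ (s₀ ∷ s) (λ ())
... | s' , y , e' rewrite e'
    with ∷ʳ-injective vK (vA ++ a ∷ s') (trans e (sym (++-assoc vA (a ∷ s') [ y ])))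
... | _ , refl = ¬df (Chronicle.lin (isChron X _ h) vA a s' k [] e)

¬positive-focus-clash : ∀ {S} (X : Design S) vA vK a k {ζ} → chr X (vA ∷ʳ a) → chr X (vK ∷ʳ k) →
                        pol a ≡ pos → pol k ≡ pos → focus a ≡ just ζ → focus k ≡ just ζ → vA ≢ vK →
                        (∀ x y → x ∈ vA → y ∈ vK → x ≢ y → DistinctFocus x y) → ⊥
¬positive-focus-clash X vA vK a k {ζ} h₁ h₂ pa pk fa fk vA≢vK distinct
  with CohChron.diverge (coherent X _ _ h₁ h₂)
... | inj₁ (inj₁ (s , e)) =
  ¬prefix-focus-clash X vA vK a k s h₂ (trans e (++-assoc vA [ a ] s)) vA≢vK (λ d → d ζ fa fk)
... | inj₁ (inj₂ (s , e)) =
  ¬prefix-focus-clash X vK vA k a s h₁ (trans e (++-assoc vK [ k ] s)) (λ q → vA≢vK (sym q))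
    (λ d → d ζ fk fa)
... | inj₂ (w , k₁ , r₁ , k₂ , r₂ , e₁ , e₂ , k₁≢k₂ , n₁ , n₂) =
  CohChron.propag (coherent X _ _ h₁ h₂) w k₁ r₁ k₂ r₂ e₁ e₂
    (distinct k₁ k₂ (neg∈init k₁ r₁ e₁ n₁ pa) (neg∈init k₂ r₂ e₂ n₂ pk) k₁≢k₂)
    a k (last∈suffix vA w a k₁ r₁ e₁) (last∈suffix vK w k k₂ r₂ e₂) ζ fa fk
  where
  neg∈init : ∀ {v x} k' r → v ∷ʳ x ≡ w ++ k' ∷ r → pol k' ≡ neg → pol x ≡ pos → k' ∈ v
  neg∈init {v} k' r e n p with ∈-++⁻ v (subst (k' ∈_) (sym e) (∈-++⁺ʳ w (here refl)))
  ... | inj₁ m = m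
  ... | inj₂ (here refl) with trans (sym p) n
  ... | ()

¬view-focus-clash : ∀ {S} (X : Design S) s s₁ a s₂ κ {ζ} → s ≡ s₁ ++ a ∷ s₂ → Linear s → daimon ∉ s →
                    chr X (view s₁ ∷ʳ a) → chr X (view s ∷ʳ κ) → pol a ≡ pos → pol κ ≡ pos →
                    focus a ≡ just ζ → focus κ ≡ just ζ → ⊥
¬view-focus-clash X s s₁ a s₂ κ s≡ Ls nd h₁ h₂ pa pκ fa fκ =
  ¬positive-focus-clash X (view s₁) (view s) a κ h₁ h₂ pa pκ fa fκ
    (view-strict-prefix≢ s s₁ a s₂ s≡ Ls nd)
    (λ x y x∈ y∈ → Linear⇒DistinctFocus s Ls (∈-prefix-of s≡ (view⊆ s₁ x∈)) (view⊆ s y∈))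

module _ {β : Seq} (W : WFBase β) (R : Net (perp β)) where

  pos-extension-component-unique : ∀ c κ₁ κ₂ i j → chr (R i) (c ∷ʳ κ₁) → chr (R j) (c ∷ʳ κ₂) →
                                   pol κ₁ ≡ pos → pol κ₂ ≡ pos → i ≡ j
  pos-extension-component-unique [] κ₁ κ₂ i j h₁ h₂ p₁ p₂ =
    positive-component-unique {β} W i j (Chronicle-pos-head⇒left≡nothing (isChron (R i) _ h₁) p₁)
                                    (Chronicle-pos-head⇒left≡nothing (isChron (R j) _ h₂) p₂)
  pos-extension-component-unique (daimon ∷ c) κ₁ κ₂ i j h₁ h₂ p₁ p₂ =
    ⊥-elim (++∷≢[] c κ₁ [] (Chronicle.dai (isChron (R i) _ h₁) [] (c ∷ʳ κ₁) refl))
  pos-extension-component-unique (act e ξ I ∷ c) κ₁ κ₂ i j h₁ h₂ p₁ p₂ =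
    focus-component-unique {β} W R i j h₁ h₂ (here refl) (here refl) refl refl

  net-pos-deterministic : ∀ c κ₁ κ₂ → RMem (perp β) R (c ∷ʳ κ₁) → RMem (perp β) R (c ∷ʳ κ₂) →
                          pol κ₁ ≡ pos → pol κ₂ ≡ pos → κ₁ ≡ κ₂
  net-pos-deterministic c κ₁ κ₂ (i , h₁) (j , h₂) p₁ p₂
    with pos-extension-component-unique c κ₁ κ₂ i j h₁ h₂ p₁ p₂
  ... | refl = design-pos-deterministic (R i) c κ₁ κ₂ h₁ h₂ p₁ p₂

justifiers-same-focus : ∀ {a b a' b' ζ} → JustBy a b → JustBy a' b' → focus a ≡ just ζ → focus a' ≡ just ζ →
                        ∃ λ ξ → focus b ≡ just ξ × focus b' ≡ just ξ
justifiers-same-focus j j' fa fa' with justification j | justification j'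
... | record { locus = ξ ; index = k ; focus-justifier = fb ; focus-justified = fa₁ }
    | record { locus = ξ' ; index = k' ; focus-justifier = fb' ; focus-justified = fa₂ }
    with ∷ʳ-injective ξ ξ' (just-injective (trans (sym fa₁) (trans fa (trans (sym fa') fa₂))))
... | refl , _ = ξ , fb , fb'

module _ {β : Seq} (W : WFBase β) {p : List Action} (J : Justified β p) where

  ¬initial-focus-justified : ∀ {y z b ζ} → InitialIn β y → focus y ≡ just ζ → b ∈ p → JustBy z b →
                             focus z ≡ just ζ → ⊥
  ¬initial-focus-justified {y} {ζ = ζ} iy fy b∈ j fz with justification j
  ... | record { locus = ξ ; index = k ; focus-justifier = fb ; focus-justified = fa }
      with Justified⇒ExtendsSome J b∈ fb
  ... | ζ₀ , m₀ , s , refl =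
    ¬strict-extension (lociOf β) W s k m₀ (initial-focus∈lociOf β y ζ iy fy)
      (trans (just-injective (trans (sym fz) fa)) (++-assoc ζ₀ s [ k ]))

  ¬initial-opposite-same-focus : ∀ {a κ ζ} → InitialIn β a → InitialIn β κ → focus a ≡ just ζ →
                                 focus κ ≡ just ζ → pol a ≢ pol κ → ⊥
  ¬initial-opposite-same-focus {act pos ξ I} {act neg ξ I'} ia iκ refl refl _ =
    PairwiseDisjoint-head∉ ξ (right β)
      (subst PairwiseDisjoint (cong (λ l → maybeList l ++ right β) iκ) W) ia
  ¬initial-opposite-same-focus {act neg ξ I} {act pos ξ I'} ia iκ refl refl _ =
    PairwiseDisjoint-head∉ ξ (right β)
      (subst PairwiseDisjoint (cong (λ l → maybeList l ++ right β) ia) W) iκ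
  ¬initial-opposite-same-focus {act pos ξ I} {act pos ξ I'} ia iκ refl refl np = np refl
  ¬initial-opposite-same-focus {act neg ξ I} {act neg ξ I'} ia iκ refl refl np = np refl

  ¬opposite-same-focus : ∀ {u κ r a ζ} → p ≡ u ++ κ ∷ r → Linear u → a ∈ u → focus a ≡ just ζ →
                         focus κ ≡ just ζ → pol a ≢ pol κ → ⊥
  ¬opposite-same-focus {u} {κ} {r} {a} p≡ Lu a∈ fa fκ np with ∈-∃++ a∈
  ... | u₁ , u₂ , refl
      with J u₁ a (u₂ ++ κ ∷ r) (trans p≡ (++-assoc u₁ (a ∷ u₂) (κ ∷ r))) (focus⇒IsProper fa)
         | J (u₁ ++ a ∷ u₂) κ r p≡ (focus⇒IsProper fκ)
  ... | inj₁ ia | inj₁ iκ = ¬initial-opposite-same-focus ia iκ fa fκ np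
  ... | inj₁ ia | inj₂ (b , b∈ , j) = ¬initial-focus-justified ia fa (∈-prefix-of p≡ b∈) j fκ
  ... | inj₂ (b , b∈ , j) | inj₁ iκ =
    ¬initial-focus-justified iκ fκ (∈-prefix-of p≡ (∈-++⁺ˡ b∈)) j fa
  ... | inj₂ (b , b∈ , j) | inj₂ (b' , b'∈ , j') with justifiers-same-focus j j' fa fκ
  ... | ξ , fb , fb' =
    Linear⇒DistinctFocus _ Lu (∈-++⁺ˡ b∈) b'∈ b≢b' ξ fb fb'
    where
    b≢b' : b ≢ b'
    b≢b' refl = np (trans (Justification.pol-justified (justification {a} {b} j))
                          (sym (Justification.pol-justified (justification {κ} {b} j'))))

-- Enough of a path of the net R for any two such sequences to be coherent; ⟨R ← D⟩ is one.
record CounterPath (β : Seq) (R : Net (perp β)) (q : List Action) : Set₁ where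
  field
    linear   : Linear q
    views    : ∀ u v → q ≡ u ++ v → u ≢ [] → RMem (perp β) R (view u)
    neg-head : ∀ a r → q ≡ a ∷ r → pol a ≡ neg → left β ≡ nothing

-- Normalization sequences

module Interaction {β : Seq} (W : WFBase β) {D : Design β} {R : Net (perp β)} {w : List Action}
                   (N : Normalizes D R w) where
  open ≡-Reasoning

  d-move : ∀ u κ r → w ≡ u ++ κ ∷ r → pol κ ≡ pos → chr D (view u ∷ʳ κ)
  d-move u κ r e p = subst (chr D) (view-∷ʳ-pos u κ p) (Normalizes.dMoves N u κ r e p)

  r-move : ∀ u κ r → w ≡ u ++ κ ∷ r → pol κ ≡ neg → RMem (perp β) R (view (dualSeq u) ∷ʳ dualA κ)
  r-move u κ r e p = subst (RMem (perp β) R) (view-dualSeq-∷ʳ-neg u κ p) (Normalizes.rMoves N u κ r e p)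

  -- A negative action of D is a positive action of R, justified in the view of R's sequence.
  justified : Justified β w
  justified u (act pos ξ I) r e _
    with Chronicle.posJ (isChron D _ (d-move u (act pos ξ I) r e refl)) (view u) (act pos ξ I) [] refl
                        (properPos ξ I)
  ... | inj₁ i            = inj₁ i
  ... | inj₂ (b , b∈ , j) = inj₂ (b , view⊆ u b∈ , j)
  justified u (act neg ξ I) r e _ with r-move u (act neg ξ I) r e refl
  ... | i , h
      with Chronicle.posJ (isChron (R i) _ h) (view (dualSeq u)) (act pos ξ I) [] refl (properPos ξ I)
  ... | inj₁ iR = inj₁ (right-component⇒left β i iR)
  ... | inj₂ (b' , b'∈ , j) with ∈-map⁻ dualA (view⊆ (dualSeq u) b'∈)
  ... | b , b∈ , refl = inj₂ (b , b∈ , subst T (justB-dualA b (act neg ξ I)) j)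

  daimon∉init : ∀ u κ r → w ≡ u ++ κ ∷ r → daimon ∉ u
  daimon∉init u κ r e m with ∈-∃++ m
  ... | u₁ , u₂ , refl =
    ++∷≢[] u₂ κ r (Normalizes.dai N u₁ (u₂ ++ κ ∷ r) (trans e (++-assoc u₁ (daimon ∷ u₂) (κ ∷ r))))

  private
    pol-≢ : ∀ {x y e f : Pol} → x ≡ e → y ≡ f → e ≢ f → x ≢ y
    pol-≢ refl refl e≢f = e≢f

  -- Two actions of the same polarity on one focus would be read in views that are distinct
  -- chronicles of D (or of one component of R, after dualising).
  focus-fresh : ∀ u κ r → w ≡ u ++ κ ∷ r → Linear u → ∀ a → a ∈ u → DistinctFocus a κ
  focus-fresh u κ r e Lu a a∈ ζ fa fκ with ∈-∃++ a∈ | pol a in pa | pol κ in pκ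
  ... | u₁ , u₂ , eu | pos | pos =
    ¬view-focus-clash D u u₁ a u₂ κ eu Lu (daimon∉init u κ r e)
      (d-move u₁ a (u₂ ++ κ ∷ r) (++∷-refine e eu) pa) (d-move u κ r e pκ) pa pκ fa fκ
  ... | _ | pos | neg = ¬opposite-same-focus W justified e Lu a∈ fa fκ (pol-≢ pa pκ λ ())
  ... | _ | neg | pos = ¬opposite-same-focus W justified e Lu a∈ fa fκ (pol-≢ pa pκ λ ())
  ... | u₁ , u₂ , eu | neg | neg
      with r-move u₁ a (u₂ ++ κ ∷ r) (++∷-refine e eu) pa
         | r-move u κ r e pκ
  ... | i , h₁ | j , h₂
      with focus-component-unique {β} W R i j h₁ h₂ (∈-++⁺ʳ _ (here refl)) (∈-++⁺ʳ _ (here refl))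
             (trans (focus-dualA a) fa) (trans (focus-dualA κ) fκ)
  ... | refl =
    ¬view-focus-clash (R i) (dualSeq u) (dualSeq u₁) (dualA a) (dualSeq u₂) (dualA κ)
      (trans (cong dualSeq eu) (dualSeq-++ u₁ (a ∷ u₂))) (Linear-dualSeq u Lu)
      (daimon∉dualSeq u (daimon∉init u κ r e)) h₁ h₂ (pol-dualA-neg a pa) (pol-dualA-neg κ pκ)
      (trans (focus-dualA a) fa) (trans (focus-dualA κ) fκ)

  linear : Linear w
  linear = prefix-linear w (reverseView w) ([] , sym (++-identityʳ w))
    where
    prefix-linear : ∀ u → Reverse u → (∃ λ r → w ≡ u ++ r) → Linear u
    prefix-linear .[] [] _ u κ v κ' r e = ⊥-elim (++∷≢[] u κ _ (sym e))
    prefix-linear .(xs ∷ʳ x) (xs ∶ rs ∶ʳ x) (r , e) =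
      Linear-∷ʳ xs x IH (focus-fresh xs x r e' IH)
      where
      e' : w ≡ xs ++ x ∷ r
      e' = trans e (++-assoc xs [ x ] r)
      IH : Linear xs
      IH = prefix-linear xs rs (x ∷ r , e')

  -- A negative action of D that ends the interaction was answered by R's daimon, which would
  -- follow a positive action of R.
  neg-followed-by-pos : ∀ u κ r → w ≡ u ++ κ ∷ r → pol κ ≡ neg →
                        ∃₂ λ κ' r' → r ≡ κ' ∷ r' × pol κ' ≡ pos
  neg-followed-by-pos u κ (κ' ∷ r') e p = κ' , r' , refl , trans (Normalizes.alt N u κ κ' r' e) (cong opp p)
  neg-followed-by-pos u κ [] e p with Normalizes.ends N
  ... | inj₁ (u' , e') with ∷ʳ-injective u' u (trans (sym e') e)
  ...   | _ , refl with p
  ...   | ()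
  neg-followed-by-pos u κ [] e p | inj₂ (_ , i , h)
    with Chronicle.alt (isChron (R i) _ (subst (chr (R i)) view≡ h)) (view (dualSeq u)) (dualA κ) daimon []
                       refl
    where
    view≡ : view (dualSeq w ∷ʳ daimon) ≡ view (dualSeq u) ++ dualA κ ∷ daimon ∷ []
    view≡ = begin
      view (dualSeq w ∷ʳ daimon)                ≡⟨ cong (λ v → view (dualSeq v ∷ʳ daimon)) e ⟩
      view (dualSeq (u ∷ʳ κ) ∷ʳ daimon)         ≡⟨ view-∷ʳ-pos (dualSeq (u ∷ʳ κ)) daimon refl ⟩
      view (dualSeq (u ∷ʳ κ)) ∷ʳ daimon         ≡⟨ cong (_∷ʳ daimon) (view-dualSeq-∷ʳ-neg u κ p) ⟩
      view (dualSeq u) ∷ʳ dualA κ ∷ʳ daimon     ≡⟨ ++-assoc (view (dualSeq u)) [ dualA κ ] [ daimon ] ⟩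
      view (dualSeq u) ++ dualA κ ∷ daimon ∷ [] ∎
  ... | alt with trans alt (cong opp (pol-dualA-neg κ p))
  ... | ()

  justified-in-base : ∀ u κ r → w ≡ u ++ κ ∷ r → IsProper κ →
                      InitialNet (β ∷ []) κ ⊎ (∃ λ b → b ∈ u × JustBy κ b)
  justified-in-base u κ r e pr with justified u κ r e pr
  ... | inj₁ i  = inj₁ (here i)
  ... | inj₂ j  = inj₂ j

  pos-justified-in-view : ∀ u κ r → w ≡ u ++ κ ∷ r → IsProperPos κ → ¬ InitialNet (β ∷ []) κ →
                          ∃ λ b → b ∈ view u × pol b ≡ neg × JustBy κ b
  pos-justified-in-view u κ r e (properPos ξ I) ¬i
    with Chronicle.posJ (isChron D _ (d-move u κ r e refl)) (view u) κ [] refl (properPos ξ I)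
  ... | inj₁ i            = ⊥-elim (¬i (here i))
  ... | inj₂ (b , b∈ , j) =
    b , b∈ , neg-justifier (Justification.pol-justified (justification {κ} {b} j)) , j
    where
    neg-justifier : ∀ {e} → pos ≡ opp e → e ≡ neg
    neg-justifier {neg} _ = refl

  pos-initial-position : ∀ u κ r → w ≡ u ++ κ ∷ r → ∀ S → S ∈ β ∷ [] → IsProperPos κ → InitialIn S κ →
                         (u ≡ [] × left S ≡ nothing) ⊎ (∃₂ λ u' b → u ≡ u' ∷ʳ b × pol b ≡ neg × HJ w S b)
  pos-initial-position u κ r e .β (here refl) (properPos ξ I) _ with initLast u
  ... | [] = inj₁ (refl , Chronicle-pos-head⇒left≡nothing (isChron D _ (d-move [] κ r e refl)) refl)
  ... | u' ∷ʳ′ b with Normalizes.alt N u' b κ r (trans e (++-assoc u' [ b ] (κ ∷ r)))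
  ... | pb with b
  ... | act neg ζ J =
    inj₂ (u' , act neg ζ J , refl , refl ,
          Justified⇒HJ justified (∈-prefix-of e (∈-++⁺ʳ u' (here refl))) (proper neg ζ J))

  starts-daimon-or-initial : Any (λ S → left S ≡ nothing) (β ∷ []) →
                             ∃₂ λ κ r → w ≡ κ ∷ r × (κ ≡ daimon ⊎ (IsProperPos κ × InitialNet (β ∷ []) κ))
  starts-daimon-or-initial (here ln) = first w refl
    where
    first : ∀ w' → w ≡ w' →
            ∃₂ λ κ r → w ≡ κ ∷ r × (κ ≡ daimon ⊎ (IsProperPos κ × InitialNet (β ∷ []) κ))
    first [] w≡ with Normalizes.ends N
    ... | inj₁ (u , e) = ⊥-elim (++∷≢[] u daimon [] (trans (sym e) w≡))
    ... | inj₂ (_ , i , h) with left≡nothing⇒components-negative β ln i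
    ... | σ , lσ
        with Chronicle.negBase
               (isChron (R i) _ (subst (λ v → chr (R i) (view (dualSeq v ∷ʳ daimon))) w≡ h))
               σ lσ daimon [] refl
    ... | ()
    first (daimon ∷ r) w≡ = daimon , r , w≡ , inj₁ refl
    first (act pos ξ I ∷ r) w≡
      with Chronicle.posJ (isChron D _ (d-move [] (act pos ξ I) r w≡ refl)) [] (act pos ξ I) [] refl
                          (properPos ξ I)
    ... | inj₁ i = act pos ξ I , r , w≡ , inj₂ (properPos ξ I , here i)
    ... | inj₂ (_ , () , _)
    first (act neg ξ I ∷ r) w≡ with r-move [] (act neg ξ I) r w≡ refl
    ... | i , h with left≡nothing⇒components-negative β ln i
    ... | σ , lσ with trans (sym lσ) (Chronicle-pos-head⇒left≡nothing (isChron (R i) _ h) refl)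
    ... | ()

  isPath : IsPath (β ∷ []) w
  isPath = record
    { alt     = Normalizes.alt N
    ; dai     = Normalizes.dai N
    ; lin     = linear
    ; justif  = justified-in-base
    ; posView = pos-justified-in-view
    ; posInit = pos-initial-position
    ; start   = starts-daimon-or-initial
    }

  inP : InP D w
  inP = isPath , prefix-views (prefixCl D) w (Normalizes.dMoves N) neg-followed-by-pos

  r-view : ∀ u κ v → dualSeq w ≡ u ++ κ ∷ v → pol κ ≡ pos → κ ≢ daimon → RMem (perp β) R (view (u ∷ʳ κ))
  r-view u κ v e p κ≢daimon =
    subst (RMem (perp β) R) view≡
      (r-move (dualSeq u) (dualA κ) (dualSeq v) w≡ (pol-dualA-pos κ p κ≢daimon))
    where
    w≡ : w ≡ dualSeq u ++ dualA κ ∷ dualSeq v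
    w≡ = dualSeq-split w u (κ ∷ v) e
    view≡ : view (dualSeq (dualSeq u)) ∷ʳ dualA (dualA κ) ≡ view (u ∷ʳ κ)
    view≡ = trans (cong₂ (λ a b → view a ∷ʳ b) (dualSeq-involutive u) (dualA-involutive κ))
                  (sym (view-∷ʳ-pos u κ p))

  dual-alt : ∀ u κ κ' r → dualSeq w ≡ u ++ κ ∷ κ' ∷ r → pol κ ≡ neg → pol κ' ≡ pos
  dual-alt u κ κ' r e p =
    pol-dualA⁻-neg κ' (trans (Normalizes.alt N (dualSeq u) (dualA κ) (dualA κ') (dualSeq r)
                                (dualSeq-split w u (κ ∷ κ' ∷ r) e))
                             (cong opp (pol-dualA-neg κ p)))

  dual-neg-head : ∀ a r → dualSeq w ≡ a ∷ r → pol a ≡ neg → left β ≡ nothing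
  dual-neg-head a r e p =
    Chronicle-pos-head⇒left≡nothing
      (isChron D _ (d-move [] (dualA a) (dualSeq r) (dualSeq-split w [] (a ∷ r) e) (pol-dualA-neg a p)))
      (pol-dualA-neg a p)

  counterPath-ended-by-D : ∀ w₀ → w ≡ w₀ ∷ʳ daimon → CounterPath β R (dualSeq w₀)
  counterPath-ended-by-D w₀ e = record
    { linear   = Linear-dualSeq w₀ (Linear-prefix w₀ [ daimon ] (subst Linear e linear))
    ; views    = prefix-views (RMem-PrefixClosed (perp β) R) (dualSeq w₀) at-pos next
    ; neg-head = λ a r e' → dual-neg-head a (r ∷ʳ daimon) (extend {[]} e') }
    where
    extend : ∀ {u κ v} → dualSeq w₀ ≡ u ++ κ ∷ v → dualSeq w ≡ u ++ κ ∷ v ∷ʳ daimon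
    extend {u} {κ} {v} e' = begin
      dualSeq w                  ≡⟨ cong dualSeq e ⟩
      dualSeq (w₀ ∷ʳ daimon)     ≡⟨ dualSeq-++ w₀ [ daimon ] ⟩
      dualSeq w₀ ∷ʳ daimon       ≡⟨ cong (_∷ʳ daimon) e' ⟩
      (u ++ κ ∷ v) ∷ʳ daimon     ≡⟨ ++-assoc u (κ ∷ v) [ daimon ] ⟩
      u ++ κ ∷ v ∷ʳ daimon       ∎
    at-pos : ∀ u κ v → dualSeq w₀ ≡ u ++ κ ∷ v → pol κ ≡ pos → RMem (perp β) R (view (u ∷ʳ κ))
    at-pos u κ v e' p = r-view u κ (v ∷ʳ daimon) (extend e') p κ≢daimon
      where
      κ≢daimon : κ ≢ daimon
      κ≢daimon refl = daimon∉dualSeq w₀ (daimon∉init w₀ daimon [] e) (++∷⇒∈ e')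
    next : ∀ u κ v → dualSeq w₀ ≡ u ++ κ ∷ v → pol κ ≡ neg →
           ∃₂ λ κ' v' → v ≡ κ' ∷ v' × pol κ' ≡ pos
    next u κ [] e' p
      with trans (Normalizes.alt N (dualSeq u) (dualA κ) daimon [] (dualSeq-split w u _ (extend e')))
                 (cong opp (pol-dualA-neg κ p))
    ... | ()
    next u κ (κ' ∷ v') e' p = κ' , v' , refl , dual-alt u κ κ' (v' ∷ʳ daimon) (extend e') p

  counterPath-ended-by-R : daimon ∉ w → RMem (perp β) R (view (dualSeq w ∷ʳ daimon)) →
                           CounterPath β R (dualSeq w ∷ʳ daimon)
  counterPath-ended-by-R nd R-daimon = record
    { linear   = Linear-∷ʳ (dualSeq w) daimon (Linear-dualSeq w linear) (λ a m ζ fa ())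
    ; views    = prefix-views (RMem-PrefixClosed (perp β) R) (dualSeq w ∷ʳ daimon) at-pos next
    ; neg-head = neg-head }
    where
    at-pos : ∀ u κ v → dualSeq w ∷ʳ daimon ≡ u ++ κ ∷ v → pol κ ≡ pos → RMem (perp β) R (view (u ∷ʳ κ))
    at-pos u κ v e p with ∷ʳ≡++∷-split (dualSeq w) u daimon κ v e
    ... | inj₁ (refl , refl , refl) = R-daimon
    ... | inj₂ (v' , _ , e') = r-view u κ v' e' p κ≢daimon
      where
      κ≢daimon : κ ≢ daimon
      κ≢daimon refl = daimon∉dualSeq w nd (++∷⇒∈ e')
    next : ∀ u κ v → dualSeq w ∷ʳ daimon ≡ u ++ κ ∷ v → pol κ ≡ neg →
           ∃₂ λ κ' v' → v ≡ κ' ∷ v' × pol κ' ≡ pos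
    next u κ v e p with ∷ʳ≡++∷-split (dualSeq w) u daimon κ v e
    ... | inj₁ (_ , _ , refl) with p
    ... | ()
    next u κ v e p | inj₂ ([] , refl , _) = daimon , [] , refl , refl
    next u κ v e p | inj₂ (κ' ∷ v' , refl , e') = κ' , v' ∷ʳ daimon , refl , dual-alt u κ κ' v' e' p
    neg-head : ∀ a r → dualSeq w ∷ʳ daimon ≡ a ∷ r → pol a ≡ neg → left β ≡ nothing
    neg-head a r e p with ∷ʳ≡++∷-split (dualSeq w) [] daimon a r e
    ... | inj₁ (_ , _ , refl) with p
    ... | ()
    neg-head a r e p | inj₂ (r' , _ , e') = dual-neg-head a r' e' p

  counterPath : CounterPath β R (tilde w)
  counterPath with Normalizes.ends N
  ... | inj₁ (w₀ , e) =
    subst (CounterPath β R) (sym (trans (cong tilde e) (tilde-∷ʳ-daimon w₀)))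
      (counterPath-ended-by-D w₀ e)
  ... | inj₂ (nd , R-daimon) =
    subst (CounterPath β R) (sym (tilde-daimon-free w nd)) (counterPath-ended-by-R nd R-daimon)

-- Coherence of counter-paths

module _ {β : Seq} (W : WFBase β) (R : Net (perp β)) where

  head∈R : ∀ {q} → CounterPath β R q → ∀ a r → q ≡ a ∷ r → RMem (perp β) R [ a ]
  head∈R Q a r e = subst (RMem (perp β) R) view-[ a ] (CounterPath.views Q [ a ] r e (λ ()))

  ¬pos-neg-heads : ∀ {q₁ q₂} → CounterPath β R q₁ → CounterPath β R q₂ → ∀ a₁ r₁ a₂ r₂ →
                   q₁ ≡ a₁ ∷ r₁ → q₂ ≡ a₂ ∷ r₂ → pol a₁ ≡ pos → pol a₂ ≡ neg → ⊥
  ¬pos-neg-heads Q₁ Q₂ a₁ r₁ a₂ r₂ e₁ e₂ p₁ p₂ with head∈R Q₁ a₁ r₁ e₁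
  ... | i , h with left≡nothing⇒components-negative β (CounterPath.neg-head Q₂ a₂ r₂ e₂ p₂) i
  ... | σ , lσ with trans (sym lσ) (Chronicle-pos-head⇒left≡nothing (isChron (R i) _ h) p₁)
  ... | ()

  heads-coherent : ∀ {q₁ q₂} → CounterPath β R q₁ → CounterPath β R q₂ → ∀ a₁ r₁ a₂ r₂ →
                   q₁ ≡ a₁ ∷ r₁ → q₂ ≡ a₂ ∷ r₂ → pol a₁ ≡ pol a₂ × (pol a₁ ≡ pos → a₁ ≡ a₂)
  heads-coherent Q₁ Q₂ a₁ r₁ a₂ r₂ e₁ e₂ with pol a₁ in p₁ | pol a₂ in p₂
  ... | pos | pos =
    refl , λ _ → net-pos-deterministic {β} W R [] a₁ a₂ (head∈R Q₁ a₁ r₁ e₁) (head∈R Q₂ a₂ r₂ e₂) p₁ p₂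
  ... | neg | neg = refl , λ ()
  ... | pos | neg = ⊥-elim (¬pos-neg-heads Q₁ Q₂ a₁ r₁ a₂ r₂ e₁ e₂ p₁ p₂)
  ... | neg | pos = ⊥-elim (¬pos-neg-heads Q₂ Q₁ a₂ r₂ a₁ r₁ e₂ e₁ p₂ p₁)

  pos-view∈R : ∀ {q} → CounterPath β R q → ∀ u κ r → q ≡ u ++ κ ∷ r → pol κ ≡ pos →
               RMem (perp β) R (view u ∷ʳ κ)
  pos-view∈R Q u κ r e p = subst (RMem (perp β) R) (view-∷ʳ-pos u κ p)
    (CounterPath.views Q (u ∷ʳ κ) r (trans e (sym (++-assoc u [ κ ] r))) (++∷≢[] u κ []))

  pos-determined-by-view : ∀ {q₁ q₂} → CounterPath β R q₁ → CounterPath β R q₂ → ∀ w₁ κ₁ r₁ w₂ κ₂ r₂ →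
                           q₁ ≡ w₁ ++ κ₁ ∷ r₁ → q₂ ≡ w₂ ++ κ₂ ∷ r₂ → pol κ₁ ≡ pos → pol κ₂ ≡ pos →
                           view w₁ ≡ view w₂ → κ₁ ≡ κ₂
  pos-determined-by-view Q₁ Q₂ w₁ κ₁ r₁ w₂ κ₂ r₂ e₁ e₂ p₁ p₂ v≡ =
    net-pos-deterministic {β} W R (view w₁) κ₁ κ₂ (pos-view∈R Q₁ w₁ κ₁ r₁ e₁ p₁)
      (subst (λ v → RMem (perp β) R (v ∷ʳ κ₂)) (sym v≡) (pos-view∈R Q₂ w₂ κ₂ r₂ e₂ p₂)) p₁ p₂

  -- If κ survives in the view at σ, that view is the view at κ continued, hence a chronicle of R
  -- extending ⌜w₀⌝ κ, where w₀ is the justifier-prefix of κ.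
  chronicle-through : ∀ {q} → CounterPath β R q → ∀ w κ x σ y → q ≡ w ++ κ ∷ x ++ σ ∷ y → pol κ ≡ neg →
                      κ ∈ view (w ++ κ ∷ x ∷ʳ σ) →
                      Σ (Fin (length (perp β))) λ i → ∃ λ t →
                        chr (R i) (view (justPrefix w κ) ++ κ ∷ t) × σ ∈ κ ∷ t
  chronicle-through Q w (act neg ζ I) x σ y e _ κ∈
    with CounterPath.views Q _ y (trans e (sym (++∷-∷ʳ-++ w _ x σ y))) (++∷≢[] w _ _)
       | Linear⇒occurs-once w (act neg ζ I) (x ∷ʳ σ) ζ
           (Linear-prefix _ y (subst Linear (trans e (sym (++∷-∷ʳ-++ w _ x σ y))) (CounterPath.linear Q)))
           refl
  ... | i , h | ∉w , ∉xσ with view-through w (act neg ζ I) (x ∷ʳ σ) ∉w ∉xσ κ∈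
  ... | t , v≡ = i , t , subst (chr (R i)) chronicle≡ h , σ∈
    where
    κ = act neg ζ I
    chronicle≡ : view (w ++ κ ∷ x ∷ʳ σ) ≡ view (justPrefix w κ) ++ κ ∷ t
    chronicle≡ = trans v≡ (trans (cong (_++ t) (view-∷ʳ-neg w κ refl))
                                 (++-assoc (view (justPrefix w κ)) [ κ ] t))
    σ∈ : σ ∈ κ ∷ t
    σ∈ with view-∷ʳ (w ++ κ ∷ x) σ
    ... | s , vs = last∈suffix s (view (justPrefix w κ)) σ κ t
          (trans (sym vs) (trans (cong view (++-assoc w (κ ∷ x) [ σ ])) chronicle≡))

  neg-propagation : ∀ {q₁ q₂} → CounterPath β R q₁ → CounterPath β R q₂ → ∀ w₁ κ₁ r₁ w₂ κ₂ r₂ →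
                    q₁ ≡ w₁ ++ κ₁ ∷ r₁ → q₂ ≡ w₂ ++ κ₂ ∷ r₂ → pol κ₁ ≡ neg → pol κ₂ ≡ neg →
                    view (justPrefix w₁ κ₁) ≡ view (justPrefix w₂ κ₂) → DistinctFocus κ₁ κ₂ →
                    ∀ x₁ σ₁ y₁ x₂ σ₂ y₂ → r₁ ≡ x₁ ++ σ₁ ∷ y₁ → r₂ ≡ x₂ ++ σ₂ ∷ y₂ →
                    κ₁ ∈ view (w₁ ++ κ₁ ∷ x₁ ∷ʳ σ₁) → κ₂ ∈ view (w₂ ++ κ₂ ∷ x₂ ∷ʳ σ₂) →
                    DistinctFocus σ₁ σ₂
  neg-propagation Q₁ Q₂ w₁ κ₁ r₁ w₂ κ₂ r₂ e₁ e₂ p₁ p₂ v≡ df x₁ σ₁ y₁ x₂ σ₂ y₂ refl refl κ₁∈ κ₂∈ ζ f₁ f₂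
    with chronicle-through Q₁ w₁ κ₁ x₁ σ₁ y₁ e₁ p₁ κ₁∈ | chronicle-through Q₂ w₂ κ₂ x₂ σ₂ y₂ e₂ p₂ κ₂∈
  ... | i , t₁ , h₁ , σ₁∈ | j , t₂ , h₂ , σ₂∈
      with focus-component-unique {β} W R i j h₁ h₂ (∈-++⁺ʳ _ σ₁∈) (∈-++⁺ʳ _ σ₂∈) f₁ f₂
  ... | refl =
    CohChron.propag (coherent (R i) _ _ h₁ h₂') (view (justPrefix w₁ κ₁)) κ₁ t₁ κ₂ t₂ refl refl df
      σ₁ σ₂ σ₁∈ σ₂∈ ζ f₁ f₂
    where
    h₂' : chr (R i) (view (justPrefix w₁ κ₁) ++ κ₂ ∷ t₂)
    h₂' = subst (λ v → chr (R i) (v ++ κ₂ ∷ t₂)) (sym v≡) h₂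

  counterPaths-coherent : ∀ {q₁ q₂} → CounterPath β R q₁ → CounterPath β R q₂ → PathCoh q₁ q₂
  counterPaths-coherent Q₁ Q₂ = record
    { first   = heads-coherent Q₁ Q₂
    ; posDet  = pos-determined-by-view Q₁ Q₂
    ; negProp = neg-propagation Q₁ Q₂
    }

proposition5p12 : (β : Seq) → WFBase β → (E : Design β → Set) →
    (R : Net (perp β)) → InAbsPerp E R →
    Σ (List Action → Set₁) λ C →
      (∀ p → C p → V E p) ×
      (∀ D → E D → ∃ λ p → C p × InP D p) ×
      Clique (Vtilde E) (Ctilde C) ×
      ViewsEq (perp β) (Ctilde C) R
proposition5p12 β W E R (R' , R'∈E⊥ , R≡|R'|) =
  C , C⊆V , C-meets-P , (C̃⊆Ṽ , C̃-coherent) , (R⊆views , views⊆R)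
  where
  C : List Action → Set₁
  C p = Σ (Design β) λ D → E D × Normalizes D R' p

  C⊆V : ∀ p → C p → V E p
  C⊆V p (D , D∈E , N) = D , D∈E , R' , R'∈E⊥ , N

  C-meets-P : ∀ D → E D → ∃ λ p → C p × InP D p
  C-meets-P D D∈E with R'∈E⊥ D D∈E
  ... | w , N = w , (D , D∈E , N) , Interaction.inP W N

  C̃⊆Ṽ : ∀ q → Ctilde C q → Vtilde E q
  C̃⊆Ṽ q (p , p∈C , q≡) = p , C⊆V p p∈C , q≡

  C̃-coherent : ∀ q₁ q₂ → Ctilde C q₁ → Ctilde C q₂ → PathCoh q₁ q₂
  C̃-coherent _ _ (_ , (_ , _ , N₁) , refl) (_ , (_ , _ , N₂) , refl) =
    counterPaths-coherent W R' (Interaction.counterPath W N₁) (Interaction.counterPath W N₂)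

  R⊆views : ∀ i c → chr (R i) c → ∃ λ q → Ctilde C q × ViewOfPrefix q c
  R⊆views i c h with proj₁ (R≡|R'| i c) h
  ... | _ , D , D∈E , w , N , vp = tilde w , (w , (D , D∈E , N) , refl) , vp

  views⊆R : ∀ c → (∃ λ q → Ctilde C q × ViewOfPrefix q c) → RMem (perp β) R c
  views⊆R c (_ , (w , (D , D∈E , N) , refl) , (u , v , e , ne , refl))
    with CounterPath.views (Interaction.counterPath W N) u v e ne
  ... | i , h =
    i , proj₂ (R≡|R'| i (view u)) (isChron (R' i) _ h , D , D∈E , w , N , (u , v , e , ne , refl))
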